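{- For every graph $G$, $\operatorname{smw}(G) \leq \operatorname{tw}(G) + 1$, where $\operatorname{tw}(G)$ is the treewidth of $G$. Moreover, for every class of graphs on which sm-width is bounded, clique-width is also bounded.
   Context: All graphs are finite, simple and undirected. A split of a connected graph $G$ is a partition $(V_1,V_2)$ of $V(G)$ with $|V_1|,|V_2|\ge 2$ such that every vertex of $V_1$ with a neighbour in $V_2$ has the same neighbourhood in $V_2$. For $A\subseteq V(G)$, $\operatorname{mm}(A)$ is the maximum size of a matching in the bipartite graph of edges of $G$ between $A$ and $V(G)\setminus A$, and $\operatorname{sm}(A)=1$ if $(A,V(G)\setminus A)$ is a split of $G$, else $\operatorname{sm}(A)=\operatorname{mm}(A)$. A branch decomposition $(T,\delta)$ of $G$ consists of a tree $T$ of maximum degree 3 and a bijection $\delta$ from the leaves of $T$ to $V(G)$; each edge $e$ of $T$ induces the cut $(X,V(G)\setminus X)$ where $X$ is the image under $\delta$ of the leaves of one component of $T-e$. The sm-width of $(T,\delta)$ is the maximum of $\operatorname{sm}(X)$ over all cuts induced by edges of $T$, and $\operatorname{smw}(G)$ is the minimum sm-width over all branch decompositions of $G$. -}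

module Defs where

open import Data.Nat using (ℕ; zero; suc; _+_; _≤_)
open import Data.Bool using (Bool; true; false; _∨_; _∧_; if_then_else_)
open import Data.Fin using (Fin; splitAt)
open import Data.Fin.Properties using (_≟_)
open import Data.Fin.Subset using (Subset; _∈_; _∉_; ∁; ∣_∣)
open import Data.Vec using (tabulate)
open import Data.List using (List; []; _∷_; _++_; [_]; length; map)
open import Data.List.Relation.Unary.Unique.Propositional using (Unique)
open import Data.List.Relation.Unary.Linked using (Linked)
open import Data.List.Relation.Unary.All using (All)
open import Data.Product using (Σ; _×_; _,_; proj₁; proj₂; ∃; ∃-syntax)
open import Data.Sum using (_⊎_; inj₁; inj₂)
open import Relation.Nullary using (¬_)
open import Relation.Nullary.Decidable using (⌊_⌋)
open import Relation.Binary.PropositionalEquality using (_≡_; _≢_)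
open import Function.Bundles using (_↔_; Inverse)

record Graph (n : ℕ) : Set where
  field
    adj    : Fin n → Fin n → Bool
    sym    : ∀ x y → adj x y ≡ adj y x
    irrefl : ∀ x → adj x x ≡ false

open Graph public

E : ∀ {n} → Graph n → Fin n → Fin n → Set
E G x y = adj G x y ≡ true

degree : ∀ {n} → Graph n → Fin n → ℕ
degree G v = ∣ tabulate (adj G v) ∣

data Reach {m : ℕ} (R : Fin m → Fin m → Set) : Fin m → Fin m → Set where
  here : ∀ {x} → Reach R x x
  step : ∀ {x y z} → R x y → Reach R y z → Reach R x z

Connected : ∀ {m} → Graph m → Set
Connected T = ∀ x y → Reach (E T) x y

IsCycle : ∀ {m} → Graph m → Fin m → List (Fin m) → Set
IsCycle T x ys = (2 ≤ length ys) × Unique (x ∷ ys) × Linked (E T) (x ∷ ys ++ [ x ])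

Acyclic : ∀ {m} → Graph m → Set
Acyclic T = ∀ x ys → ¬ IsCycle T x ys

IsTree : ∀ {m} → Graph m → Set
IsTree T = Connected T × Acyclic T

MaxDegree≤ : ∀ {m} → Graph m → ℕ → Set
MaxDegree≤ T d = ∀ v → degree T v ≤ d

IsLeaf : ∀ {m} → Graph m → Fin m → Set
IsLeaf T t = degree T t ≤ 1

-- Tree decompositions; "tree decomposition with all bags of size ≤ b"
-- (so tw(G) + 1 ≤ b iff such a decomposition exists)

record TreeDecomposition {n : ℕ} (G : Graph n) (b : ℕ) : Set where
  field
    m        : ℕ
    T        : Graph m
    isTree   : IsTree T
    bag      : Fin m → Subset n
    covV     : ∀ v → ∃[ t ] (v ∈ bag t)
    covE     : ∀ u v → E G u v → ∃[ t ] (u ∈ bag t × v ∈ bag t)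
    subtree  : ∀ v t t' → v ∈ bag t → v ∈ bag t' →
               Reach (λ x y → E T x y × v ∈ bag x × v ∈ bag y) t t'
    bagSize  : ∀ t → ∣ bag t ∣ ≤ b

IsSplit : ∀ {n} → Graph n → Subset n → Set
IsSplit G A =
  (2 ≤ ∣ A ∣) × (2 ≤ ∣ ∁ A ∣) ×
  (∀ x y → x ∈ A → y ∈ A →
     (∃[ z ] (z ∉ A × E G x z)) → (∃[ z ] (z ∉ A × E G y z)) →
     ∀ z → z ∉ A → adj G x z ≡ adj G y z)

IsCrossMatching : ∀ {n} → Graph n → Subset n → List (Fin n × Fin n) → Set
IsCrossMatching G A M =
  All (λ p → proj₁ p ∈ A × proj₂ p ∉ A × E G (proj₁ p) (proj₂ p)) M ×
  Unique (map proj₁ M) × Unique (map proj₂ M)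

mm≤ : ∀ {n} → Graph n → Subset n → ℕ → Set
mm≤ G A b = ∀ M → IsCrossMatching G A M → length M ≤ b

sm≤ : ∀ {n} → Graph n → Subset n → ℕ → Set
sm≤ G A b = (IsSplit G A → 1 ≤ b) × (¬ IsSplit G A → mm≤ G A b)

record BranchDecomposition {n : ℕ} (G : Graph n) : Set where
  field
    m       : ℕ
    T       : Graph m
    isTree  : IsTree T
    maxDeg3 : MaxDegree≤ T 3
    δ       : Σ (Fin m) (IsLeaf T) ↔ Fin n

  leafOf : Fin n → Fin m
  leafOf v = proj₁ (Inverse.from δ v)

  TminusEdge : Fin m → Fin m → Fin m → Fin m → Set
  TminusEdge t u x y = E T x y × ¬ (x ≡ t × y ≡ u) × ¬ (x ≡ u × y ≡ t)

  IsCutOf : Fin m → Fin m → Subset n → Set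
  IsCutOf t u A = ∀ v → (v ∈ A → Reach (TminusEdge t u) t (leafOf v))
                      × (Reach (TminusEdge t u) t (leafOf v) → v ∈ A)

  smWidth≤ : ℕ → Set
  smWidth≤ b = ∀ t u → E T t u → ∀ A → IsCutOf t u A → sm≤ G A b

smw≤ : ∀ {n} → Graph n → ℕ → Set
smw≤ G b = Σ (BranchDecomposition G) (λ D → BranchDecomposition.smWidth≤ D b)

tw+1≤ : ∀ {n} → Graph n → ℕ → Set
tw+1≤ G b = TreeDecomposition G b

data Expr (k : ℕ) : ℕ → Set where
  vtx   : Fin k → Expr k 1
  _⊕_   : ∀ {a b} → Expr k a → Expr k b → Expr k (a + b)
  join  : ∀ {a} (i j : Fin k) → i ≢ j → Expr k a → Expr k a
  relab : ∀ {a} (i j : Fin k) → Expr k a → Expr k a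

label : ∀ {k a} → Expr k a → Fin a → Fin k
label (vtx i) _ = i
label (_⊕_ {a} e f) x with splitAt a x
... | inj₁ x' = label e x'
... | inj₂ x' = label f x'
label (join i j _ e) x = label e x
label (relab i j e) x = if ⌊ label e x ≟ i ⌋ then j else label e x

eadj : ∀ {k a} → Expr k a → Fin a → Fin a → Bool
eadj (vtx i) _ _ = false
eadj (_⊕_ {a} e f) x y with splitAt a x | splitAt a y
... | inj₁ x' | inj₁ y' = eadj e x' y'
... | inj₂ x' | inj₂ y' = eadj f x' y'
... | inj₁ _  | inj₂ _  = false
... | inj₂ _  | inj₁ _  = false
eadj (join i j _ e) x y =
  eadj e x y ∨ ((⌊ label e x ≟ i ⌋ ∧ ⌊ label e y ≟ j ⌋) ∨ (⌊ label e x ≟ j ⌋ ∧ ⌊ label e y ≟ i ⌋))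
eadj (relab i j e) x y = eadj e x y

cw≤ : ∀ {n} → Graph n → ℕ → Set
cw≤ {n} G k = Σ (Expr k n) λ e → Σ (Fin n ↔ Fin n) λ φ →
  ∀ x y → eadj e (Inverse.to φ x) (Inverse.to φ y) ≡ adj G x y

{-# OPTIONS --safe #-}
module Submission where

-- Root a tree decomposition of width b - 1 and attach every vertex to one bag containing it. The
-- vertices attached below a node t are separated from the others by the bag at t, so all edges
-- leaving that set are covered by at most b vertices and every matching across it has at most b
-- edges. These nested sets form a binary tree with the vertices as leaves; joining its positions
-- parent to child gives a branch decomposition whose cuts are exactly these sets and their
-- complements, hence of sm-width at most b (a split only needs b ≥ 1).
--
-- Conversely, root a branch decomposition of sm-width k at an edge. For a cut (A, V ∖ A), if A is a
-- split, its vertices with neighbours outside A all have the same ones; otherwise a maximal matching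
-- across the cut has at most k edges, its endpoints cover all crossing edges, and the vertices of
-- A have at most k + 2ᵏ distinct neighbourhoods outside A. Labelling by these classes, a
-- clique-width expression is built bottom-up, with three ranges of labels so that the two parts
-- being joined and the finished result never share a label.

open import Defs hiding (sym)
open import Data.Nat using (ℕ; zero; suc; _+_; _*_; _^_; _≤_; _<_; z≤n; s≤s)
open import Data.Nat.Properties
  using (≤-refl; ≤-trans; ≤-reflexive; ≤-antisym; ≤-irrelevant; <⇒≱; +-suc; m<m+n; n≤1+n; +-mono-≤; ^-monoʳ-≤; _≤?_)
open import Data.Bool using (Bool; true; false; _∨_; _∧_)
import Data.Bool.Properties as Bool
open import Data.Fin using (Fin; zero; suc; _↑ˡ_; _↑ʳ_; splitAt; combine; inject≤)
open import Data.Fin.Properties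
  using (_≟_; any?; all?; suc-injective; ↑ˡ-injective; ↑ʳ-injective; inject≤-injective; combine-injective;
         combine-injectiveˡ; combine-injectiveʳ; splitAt-↑ˡ; splitAt-↑ʳ; splitAt⁻¹-↑ˡ; splitAt⁻¹-↑ʳ; injective⇒≤)
open import Data.Fin.Subset using (Subset; _∈_; _∉_; _∪_; ⁅_⁆; ∁; ∣_∣; _-_; ⊤) renaming (⊥ to ∅)
open import Data.Fin.Subset.Properties
  using (_∈?_; ∈⊤; ∣⊤∣≡n; ∣⊥∣≡0; ∉⊥; p─⊥≡p; Empty-unique; x∈p⇒∣p-x∣<∣p∣; x∈p∧x≢y⇒x∈p-y;
         x∈⁅x⁆; x∈⁅y⁆⇒x≡y; x∈p∪q⁻; x∈p∪q⁺; x∈∁p⇒x∉p; x∉p⇒x∈∁p; x∉∁p⇒x∈p; ⊆-antisym)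
open import Data.Vec using (Vec; []; _∷_; tabulate; lookup; here; there)
open import Data.Vec.Properties using ([]=⇒lookup; lookup⇒[]=; lookup∘tabulate)
open import Data.List as List using (List; []; _∷_; _++_; [_]; length; map; filter; allFin; cartesianProduct)
open import Data.List.Properties using (length-map; length-++)
open import Data.List.Relation.Unary.All using (All; []; _∷_)
open import Data.List.Relation.Unary.All.Properties.Core using (¬Any⇒All¬)
open import Data.List.Relation.Unary.Any using (here; there; index)
open import Data.List.Relation.Unary.Any.Properties using (lookup-index; ¬Any[])
open import Data.List.Relation.Unary.AllPairs using ([]; _∷_)
open import Data.List.Relation.Unary.Linked using (Linked; []; [-]; _∷_)
open import Data.List.Relation.Unary.Unique.Propositional using (Unique)
import Data.List.Relation.Unary.Unique.Propositional.Properties as Unique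
open import Data.List.Membership.Propositional using () renaming (_∈_ to _∈ₗ_)
import Data.List.Membership.DecPropositional as DecMembership
open import Data.List.Membership.Propositional.Properties
  using (∈-allFin; ∈-filter⁺; ∈-filter⁻; ∈-map⁺; ∈-++⁺ˡ; ∈-++⁺ʳ; ∈-∃++; ∈-cartesianProductWith⁺)
open import Data.Maybe using (Maybe; just; nothing)
open import Data.Product using (Σ; _×_; _,_; proj₁; proj₂; ∃; ∃-syntax)
open import Data.Sum using (_⊎_; inj₁; inj₂; [_,_]′; swap)
open import Data.Unit using (tt) renaming (⊤ to Unit)
open import Data.Empty using (⊥; ⊥-elim)
open import Relation.Nullary using (¬_; Dec; yes; no; ¬?; does)
open import Relation.Nullary.Decidable using (⌊_⌋; map′; dec-false; _×-dec_; _⊎-dec_; _→-dec_)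
open import Relation.Binary.Construct.Closure.ReflexiveTransitive using (Star; ε; _◅_; gmap; reverse)
open import Relation.Binary.PropositionalEquality using (_≡_; _≢_; refl; sym; trans; cong; cong₂; subst; subst₂; module ≡-Reasoning)
open import Function.Bundles using (Inverse; _↔_; mk↔ₛ′)

module _ {m : ℕ} {R : Fin m → Fin m → Set} where

  Reach-snoc : ∀ {x y z} → Reach R x y → R y z → Reach R x z
  Reach-snoc here r = step r here
  Reach-snoc (step r' p) r = step r' (Reach-snoc p r)

  Reach-trans : ∀ {x y z} → Reach R x y → Reach R y z → Reach R x z
  Reach-trans here q = q
  Reach-trans (step r p) q = step r (Reach-trans p q)

  Reach-reverse : (∀ {a b} → R a b → R b a) → ∀ {x y} → Reach R x y → Reach R y x
  Reach-reverse s here = here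
  Reach-reverse s (step r p) = Reach-snoc (Reach-reverse s p) (s r)

  Reach-first : ∀ {x y} → Reach R x y → x ≢ y → ∃ (R x)
  Reach-first here x≢y = ⊥-elim (x≢y refl)
  Reach-first (step r _) _ = _ , r

Reach-map : ∀ {m} {R S : Fin m → Fin m → Set} → (∀ {a b} → R a b → S a b) →
            ∀ {x y} → Reach R x y → Reach S x y
Reach-map f here = here
Reach-map f (step r p) = step (f r) (Reach-map f p)

Star⇒Reach : ∀ {A : Set} {m} {S : A → A → Set} {R : Fin m → Fin m → Set} (f : A → Fin m) →
             (∀ {a b} → S a b → R (f a) (f b)) → ∀ {p q} → Star S p q → Reach R (f p) (f q)
Star⇒Reach f g ε = here
Star⇒Reach f g (s ◅ w) = step (g s) (Star⇒Reach f g w)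

module _ {n : ℕ} (G : Graph n) where

  E-sym : ∀ {x y} → E G x y → E G y x
  E-sym {x} {y} e = trans (Graph.sym G y x) e

  E-irrefl : ∀ {x y} → E G x y → x ≢ y
  E-irrefl {x} e refl with trans (sym e) (irrefl G x)
  ... | ()

  E? : ∀ x y → Dec (E G x y)
  E? x y = adj G x y Bool.≟ true

_∈ₗ?_ : ∀ {n} (x : Fin n) xs → Dec (x ∈ₗ xs)
_∈ₗ?_ = DecMembership._∈?_ _≟_

Bool-ext : ∀ {a b : Bool} → (a ≡ true → b ≡ true) → (b ≡ true → a ≡ true) → a ≡ b
Bool-ext {false} {false} f g = refl
Bool-ext {false} {true} f g with g refl
... | ()
Bool-ext {true} {false} f g with f refl
... | ()
Bool-ext {true} {true} f g = refl

∣p∣≤1+∣p-x∣ : ∀ {n} (p : Subset n) x → ∣ p ∣ ≤ suc ∣ p - x ∣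
∣p∣≤1+∣p-x∣ (true ∷ p) zero = subst (λ q → suc ∣ p ∣ ≤ suc ∣ q ∣) (sym (p─⊥≡p p)) ≤-refl
∣p∣≤1+∣p-x∣ (false ∷ p) zero = subst (λ q → ∣ p ∣ ≤ suc ∣ q ∣) (sym (p─⊥≡p p)) (n≤1+n _)
∣p∣≤1+∣p-x∣ (true ∷ p) (suc x) = s≤s (∣p∣≤1+∣p-x∣ p x)
∣p∣≤1+∣p-x∣ (false ∷ p) (suc x) = ∣p∣≤1+∣p-x∣ p x

x∈p-y⁻ : ∀ {n} (p : Subset n) y {x} → x ∈ p - y → x ∈ p × x ≢ y
x∈p-y⁻ (b ∷ p) zero {suc x} (there x∈) = there (subst (x ∈_) (p─⊥≡p p) x∈) , λ ()
x∈p-y⁻ (true ∷ p) (suc y) {zero} here = here , λ ()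
x∈p-y⁻ (b ∷ p) (suc y) {suc x} (there x∈) with x∈p-y⁻ p y x∈
... | x∈p , x≢y = there x∈p , λ e → x≢y (suc-injective e)

∣p∣≤length : ∀ {n} (p : Subset n) ys → (∀ y → y ∈ p → y ∈ₗ ys) → ∣ p ∣ ≤ length ys
∣p∣≤length {n} p [] p⊆ys = subst (_≤ 0) (sym (trans (cong ∣_∣ p≡∅) (∣⊥∣≡0 n))) z≤n
  where
  p≡∅ : p ≡ ∅
  p≡∅ = Empty-unique λ (y , y∈p) → ¬Any[] (p⊆ys y y∈p)
∣p∣≤length p (y ∷ ys) p⊆ys = ≤-trans (∣p∣≤1+∣p-x∣ p y) (s≤s (∣p∣≤length (p - y) ys p-y⊆ys))
  where
  p-y⊆ys : ∀ z → z ∈ p - y → z ∈ₗ ys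
  p-y⊆ys z z∈ with x∈p-y⁻ p y z∈
  ... | z∈p , z≢y with p⊆ys z z∈p
  ... | here z≡y = ⊥-elim (z≢y z≡y)
  ... | there z∈ys = z∈ys

length≤∣p∣ : ∀ {n} (p : Subset n) xs → Unique xs → All (_∈ p) xs → length xs ≤ ∣ p ∣
length≤∣p∣ p [] _ _ = z≤n
length≤∣p∣ p (x ∷ xs) (x∉xs ∷ u) (x∈p ∷ xs⊆p) =
  ≤-trans (s≤s (length≤∣p∣ (p - x) xs u (xs⊆p-x xs x∉xs xs⊆p))) (x∈p⇒∣p-x∣<∣p∣ x∈p)
  where
  xs⊆p-x : ∀ ys → All (x ≢_) ys → All (_∈ p) ys → All (_∈ p - x) ys
  xs⊆p-x [] [] [] = []
  xs⊆p-x (y ∷ ys) (x≢y ∷ x≢ys) (y∈p ∷ ys⊆p) = x∈p∧x≢y⇒x∈p-y y∈p (λ e → x≢y (sym e)) ∷ xs⊆p-x ys x≢ys ys⊆p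

Unique⇒length≤ : ∀ {n} (xs : List (Fin n)) → Unique xs → length xs ≤ n
Unique⇒length≤ {n} xs u = subst (length xs ≤_) (∣⊤∣≡n n) (length≤∣p∣ ⊤ xs u (all-∈⊤ xs))
  where
  all-∈⊤ : ∀ ys → All (_∈ ⊤) ys
  all-∈⊤ [] = []
  all-∈⊤ (y ∷ ys) = ∈⊤ ∷ all-∈⊤ ys

↑ˡ≢↑ʳ : ∀ {a b} (i : Fin a) (j : Fin b) → i ↑ˡ b ≢ a ↑ʳ j
↑ˡ≢↑ʳ {a} {b} i j e with trans (sym (splitAt-↑ˡ a i b)) (trans (cong (splitAt a) e) (splitAt-↑ʳ a b j))
... | ()

Bool→Fin2 : Bool → Fin 2
Bool→Fin2 false = zero
Bool→Fin2 true = suc zero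

Bool→Fin2-injective : ∀ a b → Bool→Fin2 a ≡ Bool→Fin2 b → a ≡ b
Bool→Fin2-injective false false _ = refl
Bool→Fin2-injective true true _ = refl

bits→Fin : ∀ {l} → Vec Bool l → Fin (2 ^ l)
bits→Fin [] = zero
bits→Fin (b ∷ v) = combine (Bool→Fin2 b) (bits→Fin v)

bits→Fin-injective : ∀ {l} (u v : Vec Bool l) → bits→Fin u ≡ bits→Fin v → u ≡ v
bits→Fin-injective [] [] _ = refl
bits→Fin-injective (a ∷ u) (b ∷ v) e with combine-injective (Bool→Fin2 a) (bits→Fin u) (Bool→Fin2 b) (bits→Fin v) e
... | ea , eu = cong₂ _∷_ (Bool→Fin2-injective a b ea) (bits→Fin-injective u v eu)

↔⇒≡ : ∀ {a b} → Fin a ↔ Fin b → a ≡ b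
↔⇒≡ φ = ≤-antisym (injective⇒≤ to-injective) (injective⇒≤ from-injective)
  where
  open Inverse φ
  to-injective : ∀ {x y} → to x ≡ to y → x ≡ y
  to-injective {x} {y} e = trans (sym (strictlyInverseʳ x)) (trans (cong from e) (strictlyInverseʳ y))
  from-injective : ∀ {x y} → from x ≡ from y → x ≡ y
  from-injective {x} {y} e = trans (sym (strictlyInverseˡ x)) (trans (cong to e) (strictlyInverseˡ y))

module _ {n : ℕ} (G : Graph n) (v : Fin n) where

  degree≤length : ∀ ys → (∀ y → E G v y → y ∈ₗ ys) → degree G v ≤ length ys
  degree≤length ys nbrs⊆ys = ∣p∣≤length (tabulate (adj G v)) ys
    λ y y∈ → nbrs⊆ys y (trans (sym (lookup∘tabulate (adj G v) y)) ([]=⇒lookup y∈))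

  length≤degree : ∀ xs → Unique xs → All (E G v) xs → length xs ≤ degree G v
  length≤degree xs u xs⊆nbrs = length≤∣p∣ (tabulate (adj G v)) xs u (∈nbrs xs xs⊆nbrs)
    where
    ∈nbrs : ∀ ys → All (E G v) ys → All (_∈ tabulate (adj G v)) ys
    ∈nbrs [] [] = []
    ∈nbrs (y ∷ ys) (e ∷ es) = lookup⇒[]= y _ (trans (lookup∘tabulate (adj G v) y) e) ∷ ∈nbrs ys es

  2≤degree : ∀ {a b} → E G v a → E G v b → a ≢ b → 2 ≤ degree G v
  2≤degree ea eb a≢b = length≤degree (_ ∷ _ ∷ []) ((a≢b ∷ []) ∷ [] ∷ []) (ea ∷ eb ∷ [])

-- Rooted trees

module _ {m : ℕ} (T : Graph m) where

  TminusEdge : Fin m → Fin m → Fin m → Fin m → Set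
  TminusEdge t u x y = E T x y × ¬ (x ≡ t × y ≡ u) × ¬ (x ≡ u × y ≡ t)

  TminusEdge-sym : ∀ {t u x y} → TminusEdge t u x y → TminusEdge t u y x
  TminusEdge-sym (e , ¬tu , ¬ut) = E-sym T e , (λ { (p , q) → ¬ut (q , p) }) , (λ { (p , q) → ¬tu (q , p) })

  TminusEdge-swap : ∀ {t u x y} → TminusEdge t u x y → TminusEdge u t x y
  TminusEdge-swap (e , ¬tu , ¬ut) = e , ¬ut , ¬tu

module RootedTree {m : ℕ} (T : Graph m) (acyclic : Acyclic T) where

  data Walk (R : Fin m → Fin m → Set) : Fin m → Fin m → List (Fin m) → Set where
    [] : ∀ {x} → Walk R x x []
    _∷_ : ∀ {x z y zs} → R x z → Walk R z y zs → Walk R x y (z ∷ zs)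

  Walk-suffix : ∀ {R x z y zs} → Walk R z y zs → Unique (z ∷ zs) → x ∈ₗ (z ∷ zs) →
                ∃ λ zs' → Walk R x y zs' × Unique (x ∷ zs')
  Walk-suffix w u (here refl) = _ , w , u
  Walk-suffix (r ∷ w) (_ ∷ u) (there x∈) = Walk-suffix w u x∈

  Reach⇒simpleWalk : ∀ {R x y} → Reach R x y → ∃ λ zs → Walk R x y zs × Unique (x ∷ zs)
  Reach⇒simpleWalk here = [] , [] , [] ∷ []
  Reach⇒simpleWalk {x = x} (step {y = z} r p) with Reach⇒simpleWalk p
  ... | zs , w , u with x ∈ₗ? (z ∷ zs)
  ... | yes x∈ = Walk-suffix w u x∈
  ... | no x∉ = z ∷ zs , r ∷ w , ¬Any⇒All¬ _ x∉ ∷ u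

  Walk-linked : ∀ {R x y zs t} → (∀ {a b} → R a b → E T a b) → Walk R x y zs → E T y t →
                Linked (E T) (x ∷ zs ++ [ t ])
  Walk-linked f [] e = e ∷ [-]
  Walk-linked f (r ∷ w) e = f r ∷ Walk-linked f w e

  edge-is-bridge : ∀ {w t} → E T w t → ¬ Reach (TminusEdge T w t) w t
  edge-is-bridge {w} {t} e p with Reach⇒simpleWalk (Reach-reverse (TminusEdge-sym T) p)
  ... | [] , [] , _ = E-irrefl T e refl
  ... | z ∷ [] , (_ , _ , ¬wt) ∷ [] , _ = ¬wt (refl , refl)
  ... | z ∷ z' ∷ zs , walk , u = acyclic t (z ∷ z' ∷ zs) (s≤s (s≤s z≤n) , u , Walk-linked proj₁ walk e)

  RootPath : Fin m → List (Fin m) → Set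
  RootPath t ps = Linked (E T) (t ∷ ps) × Unique (t ∷ ps)

  NotParent : Fin m → List (Fin m) → Set
  NotParent w [] = Unit
  NotParent w (p ∷ _) = w ≢ p

  NotParent? : ∀ w ps → Dec (NotParent w ps)
  NotParent? w [] = yes tt
  NotParent? w (p ∷ _) = ¬? (w ≟ p)

  child∉RootPath : ∀ {t ps w} → RootPath t ps → E T t w → NotParent w ps → ¬ (w ∈ₗ (t ∷ ps))
  child∉RootPath _ e _ (here refl) = E-irrefl T e refl
  child∉RootPath {t} {p ∷ ps} {w} (linked , u) e w≢p (there w∈) with ∈-∃++ w∈
  ... | [] , _ , refl = w≢p refl
  ... | q ∷ pre , post , refl =
    acyclic t (q ∷ pre ++ [ w ])
      ( s≤s (1≤length-snoc pre)
      , Unique-prefix (t ∷ q ∷ pre) post u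
      , Linked-snoc (t ∷ q ∷ pre) (Linked-prefix (t ∷ q ∷ pre) post linked) (E-sym T e))
    where
    1≤length-snoc : ∀ (xs : List (Fin m)) → 1 ≤ length (xs ++ [ w ])
    1≤length-snoc [] = s≤s z≤n
    1≤length-snoc (_ ∷ _) = s≤s z≤n
    All-prefix : ∀ {P : Fin m → Set} xs ys → All P (xs ++ w ∷ ys) → All P (xs ++ [ w ])
    All-prefix [] ys (p ∷ _) = p ∷ []
    All-prefix (x ∷ xs) ys (p ∷ ps) = p ∷ All-prefix xs ys ps
    Unique-prefix : ∀ (xs : List (Fin m)) ys → Unique (xs ++ w ∷ ys) → Unique (xs ++ [ w ])
    Unique-prefix [] ys (_ ∷ _) = [] ∷ []
    Unique-prefix (x ∷ xs) ys (p ∷ u) = All-prefix xs ys p ∷ Unique-prefix xs ys u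
    Linked-prefix : ∀ xs ys → Linked (E T) (xs ++ w ∷ ys) → Linked (E T) (xs ++ [ w ])
    Linked-prefix [] ys _ = [-]
    Linked-prefix (x ∷ []) ys (r ∷ _) = r ∷ [-]
    Linked-prefix (x ∷ x' ∷ xs) ys (r ∷ l) = r ∷ Linked-prefix (x' ∷ xs) ys l
    Linked-snoc : ∀ xs → Linked (E T) (xs ++ [ w ]) → E T w t → Linked (E T) ((xs ++ [ w ]) ++ [ t ])
    Linked-snoc [] _ r = r ∷ [-]
    Linked-snoc (x ∷ []) (r' ∷ _) r = r' ∷ r ∷ [-]
    Linked-snoc (x ∷ x' ∷ xs) (r' ∷ l) r = r' ∷ Linked-snoc (x' ∷ xs) l r

  RootPath-child : ∀ {t ps w} → RootPath t ps → E T t w → NotParent w ps → RootPath w (t ∷ ps)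
  RootPath-child (linked , u) e w≢p =
    E-sym T e ∷ linked , ¬Any⇒All¬ _ (child∉RootPath (linked , u) e w≢p) ∷ u

  -- Terminates because a root path is simple and so has at most m vertices.
  rootedRec : (P : Fin m → List (Fin m) → Set) →
              (∀ t ps → RootPath t ps → (∀ w → E T t w → NotParent w ps → P w (t ∷ ps)) → P t ps) →
              ∀ t ps → RootPath t ps → P t ps
  rootedRec P rec t ps rp = go m t ps rp (m<m+n m (s≤s z≤n))
    where
    go : (fuel : ℕ) → ∀ t ps → RootPath t ps → m < fuel + length (t ∷ ps) → P t ps
    go zero t ps (_ , u) m<len = ⊥-elim (<⇒≱ m<len (Unique⇒length≤ (t ∷ ps) u))
    go (suc fuel) t ps rp m<len =
      rec t ps rp λ w e w≢p → go fuel w (t ∷ ps) (RootPath-child rp e w≢p)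
                                 (subst (m <_) (sym (+-suc fuel (length (t ∷ ps)))) m<len)

  TminusParent : Fin m → List (Fin m) → Fin m → Fin m → Set
  TminusParent t [] = E T
  TminusParent t (p ∷ _) = TminusEdge T t p

  TminusParent⇒E : ∀ {t ps a b} → TminusParent t ps a b → E T a b
  TminusParent⇒E {ps = []} e = e
  TminusParent⇒E {ps = p ∷ _} (e , _) = e

  branch-excludes : ∀ {w t a} → E T w t → Reach (TminusEdge T w t) w a → a ≢ t
  branch-excludes e p refl = edge-is-bridge e p

  InSubtree : Fin m → List (Fin m) → Fin m → Set
  InSubtree t ps x = x ≡ t ⊎ ∃ λ w → E T t w × NotParent w ps × Reach (TminusEdge T w t) w x

  InSubtree-step : ∀ {t ps a b} → InSubtree t ps a → TminusParent t ps a b → InSubtree t ps b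
  InSubtree-step {t} {[]} (inj₁ refl) e = inj₂ (_ , e , tt , here)
  InSubtree-step {t} {p ∷ _} (inj₁ refl) (e , ¬tp , _) = inj₂ (_ , e , (λ b≡p → ¬tp (refl , b≡p)) , here)
  InSubtree-step {t} {ps} {b = b} (inj₂ (w , e , w≢p , p)) r with b ≟ t
  ... | yes b≡t = inj₁ b≡t
  ... | no b≢t = inj₂ (w , e , w≢p , Reach-snoc p (TminusParent⇒E {ps = ps} r
                                                   , (λ { (_ , b≡t) → b≢t b≡t })
                                                   , (λ { (a≡t , _) → branch-excludes (E-sym T e) p a≡t })))

  Reach⇒InSubtree : ∀ {t ps x} → Reach (TminusParent t ps) t x → InSubtree t ps x
  Reach⇒InSubtree {t} {ps} = go (inj₁ refl)
    where
    go : ∀ {a x} → InSubtree t ps a → Reach (TminusParent t ps) a x → InSubtree t ps x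
    go s here = s
    go s (step r p) = go (InSubtree-step {ps = ps} s r) p

  InSubtree⇒Reach : ∀ {t ps x} → InSubtree t ps x → Reach (TminusParent t ps) t x
  InSubtree⇒Reach (inj₁ refl) = here
  InSubtree⇒Reach {t} {ps} (inj₂ (w , e , w≢p , p)) = step (first ps w≢p) (lift here p)
    where
    first : ∀ ps → NotParent w ps → TminusParent t ps t w
    first [] _ = e
    first (_ ∷ _) w≢p = e , (λ { (_ , w≡p) → w≢p w≡p }) , (λ { (_ , t≡w) → E-irrefl T e (sym t≡w) })
    inner : ∀ ps {a b} → TminusEdge T w t a b → a ≢ t → b ≢ t → TminusParent t ps a b
    inner [] (e' , _) _ _ = e'
    inner (_ ∷ _) (e' , _) a≢t b≢t = e' , (λ { (a≡t , _) → a≢t a≡t }) , (λ { (_ , b≡t) → b≢t b≡t })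
    lift : ∀ {a y} → Reach (TminusEdge T w t) w a → Reach (TminusEdge T w t) a y → Reach (TminusParent t ps) a y
    lift pa here = here
    lift pa (step r rest) =
      step (inner ps r (branch-excludes (E-sym T e) pa) (branch-excludes (E-sym T e) (Reach-snoc pa r)))
           (lift (Reach-snoc pa r) rest)

  branches-disjoint : ∀ {t w₁ w₂ x} → E T t w₁ → E T t w₂ → w₁ ≢ w₂ →
                      Reach (TminusEdge T w₁ t) w₁ x → Reach (TminusEdge T w₂ t) w₂ x → ⊥
  branches-disjoint {t} {w₁} {w₂} e₁ e₂ w₁≢w₂ p₁ p₂ =
    edge-is-bridge (E-sym T e₁) (Reach-trans p₁ (Reach-snoc (back (Reach-reverse (TminusEdge-sym T) p₂) p₂) last))
    where
    last : TminusEdge T w₁ t w₂ t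
    last = E-sym T e₂ , (λ { (w₂≡w₁ , _) → w₁≢w₂ (sym w₂≡w₁) }) , (λ { (w₂≡t , _) → E-irrefl T e₂ (sym w₂≡t) })
    back : ∀ {a} → Reach (TminusEdge T w₂ t) a w₂ → Reach (TminusEdge T w₂ t) w₂ a → Reach (TminusEdge T w₁ t) a w₂
    back here _ = here
    back (step r rest) pa =
      step ( proj₁ r , (λ { (_ , b≡t) → branch-excludes (E-sym T e₂) (Reach-snoc pa r) b≡t })
                     , (λ { (a≡t , _) → branch-excludes (E-sym T e₂) pa a≡t }))
           (back rest (Reach-snoc pa r))

  reach? : ∀ t ps → RootPath t ps → ∀ x → Dec (Reach (TminusParent t ps) t x)
  reach? = rootedRec (λ t ps → ∀ x → Dec (Reach (TminusParent t ps) t x)) step?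
    where
    step? : ∀ t ps → RootPath t ps → (∀ w → E T t w → NotParent w ps → ∀ x → Dec (Reach (TminusEdge T w t) w x)) →
            ∀ x → Dec (Reach (TminusParent t ps) t x)
    step? t ps _ rec x = map′ InSubtree⇒Reach Reach⇒InSubtree (x ≟ t ⊎-dec any? viaChild?)
      where
      viaChild? : ∀ w → Dec (E T t w × NotParent w ps × Reach (TminusEdge T w t) w x)
      viaChild? w with E? T t w | NotParent? w ps
      ... | yes e | yes w≢p = map′ (λ r → e , w≢p , r) (λ z → proj₂ (proj₂ z)) (rec w e w≢p x)
      ... | no ¬e | _ = no (λ z → ¬e (proj₁ z))
      ... | yes _ | no w≡p = no (λ z → w≡p (proj₁ (proj₂ z)))

-- Binary trees

module _ {n : ℕ} where

  data BinTree : Set where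
    leaf : Fin n → BinTree
    node : BinTree → BinTree → BinTree

  leaves : BinTree → Subset n
  leaves (leaf v) = ⁅ v ⁆
  leaves (node l r) = leaves l ∪ leaves r

  DistinctLeaves : BinTree → Set
  DistinctLeaves (leaf v) = Unit
  DistinctLeaves (node l r) = DistinctLeaves l × DistinctLeaves r × (∀ x → x ∈ leaves l → x ∉ leaves r)

  AllSubtrees : (Subset n → Set) → BinTree → Set
  AllSubtrees Q (leaf v) = Q ⁅ v ⁆
  AllSubtrees Q (node l r) = Q (leaves l ∪ leaves r) × AllSubtrees Q l × AllSubtrees Q r

  size : BinTree → ℕ
  size (leaf v) = 1
  size (node l r) = size l + size r

  leafAt : (β : BinTree) → Fin (size β) → Fin n
  leafAt (leaf v) _ = v
  leafAt (node l r) i = [ leafAt l , leafAt r ]′ (splitAt (size l) i)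

  leafAt∈leaves : ∀ β i → leafAt β i ∈ leaves β
  leafAt∈leaves (leaf v) i = x∈⁅x⁆ v
  leafAt∈leaves (node l r) i with splitAt (size l) i
  ... | inj₁ a = x∈p∪q⁺ (inj₁ (leafAt∈leaves l a))
  ... | inj₂ b = x∈p∪q⁺ (inj₂ (leafAt∈leaves r b))

  leafAt-surjective : ∀ β x → x ∈ leaves β → ∃ λ i → leafAt β i ≡ x
  leafAt-surjective (leaf v) x x∈ = zero , sym (x∈⁅y⁆⇒x≡y v x∈)
  leafAt-surjective (node l r) x x∈ with x∈p∪q⁻ (leaves l) (leaves r) x∈
  ... | inj₁ x∈l with leafAt-surjective l x x∈l
  ... | a , e = a ↑ˡ size r , trans (cong [ leafAt l , leafAt r ]′ (splitAt-↑ˡ (size l) a (size r))) e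
  leafAt-surjective (node l r) x x∈ | inj₂ x∈r with leafAt-surjective r x x∈r
  ... | b , e = size l ↑ʳ b , trans (cong [ leafAt l , leafAt r ]′ (splitAt-↑ʳ (size l) (size r) b)) e

  leafAt-injective : ∀ β → DistinctLeaves β → ∀ i j → leafAt β i ≡ leafAt β j → i ≡ j
  leafAt-injective (leaf v) _ zero zero _ = refl
  leafAt-injective (node l r) (dl , dr , disj) i j e with splitAt (size l) i in ei | splitAt (size l) j in ej
  ... | inj₁ a | inj₁ b =
    trans (sym (splitAt⁻¹-↑ˡ ei)) (trans (cong (_↑ˡ size r) (leafAt-injective l dl a b e)) (splitAt⁻¹-↑ˡ ej))
  ... | inj₂ a | inj₂ b =
    trans (sym (splitAt⁻¹-↑ʳ ei)) (trans (cong (size l ↑ʳ_) (leafAt-injective r dr a b e)) (splitAt⁻¹-↑ʳ ej))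
  ... | inj₁ a | inj₂ b = ⊥-elim (disj _ (leafAt∈leaves l a) (subst (_∈ leaves r) (sym e) (leafAt∈leaves r b)))
  ... | inj₂ a | inj₁ b = ⊥-elim (disj _ (leafAt∈leaves l b) (subst (_∈ leaves r) e (leafAt∈leaves r a)))

  leafAt-inverse : ∀ β → DistinctLeaves β → (∀ x → x ∈ leaves β) → Fin (size β) ↔ Fin n
  leafAt-inverse β d all = mk↔ₛ′ (leafAt β) index-of (λ x → proj₂ (leafAt-surjective β x (all x)))
                             (λ i → leafAt-injective β d _ _ (proj₂ (leafAt-surjective β _ (all (leafAt β i)))))
    where
    index-of : Fin n → Fin (size β)
    index-of x = proj₁ (leafAt-surjective β x (all x))

module _ {n : ℕ} where

  data Pos : BinTree {n} → Set where
    root : ∀ {β} → Pos β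
    left : ∀ {l r} → Pos l → Pos (node l r)
    right : ∀ {l r} → Pos r → Pos (node l r)

  left-injective : ∀ {l r} {p q : Pos l} → left {l} {r} p ≡ left q → p ≡ q
  left-injective refl = refl

  right-injective : ∀ {l r} {p q : Pos r} → right {l} {r} p ≡ right q → p ≡ q
  right-injective refl = refl

  _≟ₚ_ : ∀ {β} (p q : Pos β) → Dec (p ≡ q)
  root ≟ₚ root = yes refl
  root ≟ₚ left q = no (λ ())
  root ≟ₚ right q = no (λ ())
  left p ≟ₚ root = no (λ ())
  left p ≟ₚ left q = map′ (cong left) left-injective (p ≟ₚ q)
  left p ≟ₚ right q = no (λ ())
  right p ≟ₚ root = no (λ ())
  right p ≟ₚ left q = no (λ ())
  right p ≟ₚ right q = map′ (cong right) right-injective (p ≟ₚ q)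

  data Child : {β : BinTree} → Pos β → Pos β → Set where
    toLeft : ∀ {l r} → Child {node l r} root (left root)
    toRight : ∀ {l r} → Child {node l r} root (right root)
    inLeft : ∀ {l r} {p q : Pos l} → Child p q → Child {node l r} (left p) (left q)
    inRight : ∀ {l r} {p q : Pos r} → Child p q → Child {node l r} (right p) (right q)

  Child? : ∀ {β} (p q : Pos β) → Dec (Child p q)
  Child? root root = no (λ ())
  Child? root (left root) = yes toLeft
  Child? root (left (left _)) = no (λ ())
  Child? root (left (right _)) = no (λ ())
  Child? root (right root) = yes toRight
  Child? root (right (left _)) = no (λ ())
  Child? root (right (right _)) = no (λ ())
  Child? (left p) root = no (λ ())
  Child? (left p) (left q) = map′ inLeft (λ { (inLeft c) → c }) (Child? p q)
  Child? (left p) (right q) = no (λ ())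
  Child? (right p) root = no (λ ())
  Child? (right p) (left q) = no (λ ())
  Child? (right p) (right q) = map′ inRight (λ { (inRight c) → c }) (Child? p q)

  Child-irrefl : ∀ {β} {p : Pos β} → ¬ Child p p
  Child-irrefl (inLeft c) = Child-irrefl c
  Child-irrefl (inRight c) = Child-irrefl c

  parent-unique : ∀ {β} {p p' q : Pos β} → Child p q → Child p' q → p ≡ p'
  parent-unique toLeft toLeft = refl
  parent-unique toRight toRight = refl
  parent-unique toLeft (inLeft ())
  parent-unique toRight (inRight ())
  parent-unique (inLeft ()) toLeft
  parent-unique (inRight ()) toRight
  parent-unique (inLeft c) (inLeft c') = cong left (parent-unique c c')
  parent-unique (inRight c) (inRight c') = cong right (parent-unique c c')

  data _⊑_ : {β : BinTree} → Pos β → Pos β → Set where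
    root⊑ : ∀ {β} {q : Pos β} → root ⊑ q
    left⊑ : ∀ {l r} {p q : Pos l} → p ⊑ q → _⊑_ {node l r} (left p) (left q)
    right⊑ : ∀ {l r} {p q : Pos r} → p ⊑ q → _⊑_ {node l r} (right p) (right q)

  ⊑-refl : ∀ {β} {p : Pos β} → p ⊑ p
  ⊑-refl {p = root} = root⊑
  ⊑-refl {p = left p} = left⊑ ⊑-refl
  ⊑-refl {p = right p} = right⊑ ⊑-refl

  ⊑-trans : ∀ {β} {p q s : Pos β} → p ⊑ q → q ⊑ s → p ⊑ s
  ⊑-trans root⊑ _ = root⊑
  ⊑-trans (left⊑ a) (left⊑ b) = left⊑ (⊑-trans a b)
  ⊑-trans (right⊑ a) (right⊑ b) = right⊑ (⊑-trans a b)

  ⊑-child : ∀ {β} {c y z : Pos β} → c ⊑ y → Child y z → c ⊑ z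
  ⊑-child root⊑ _ = root⊑
  ⊑-child (left⊑ s) (inLeft ch) = left⊑ (⊑-child s ch)
  ⊑-child (right⊑ s) (inRight ch) = right⊑ (⊑-child s ch)

  Child⇒⊑ : ∀ {β} {y z : Pos β} → Child y z → y ⊑ z
  Child⇒⊑ = ⊑-child ⊑-refl

  ⊑-parent : ∀ {β} {c y z : Pos β} → c ⊑ y → Child z y → y ≢ c → c ⊑ z
  ⊑-parent root⊑ _ _ = root⊑
  ⊑-parent (left⊑ root⊑) toLeft y≢c = ⊥-elim (y≢c refl)
  ⊑-parent (right⊑ root⊑) toRight y≢c = ⊥-elim (y≢c refl)
  ⊑-parent (left⊑ s) (inLeft ch) y≢c = left⊑ (⊑-parent s ch (λ e → y≢c (cong left e)))
  ⊑-parent (right⊑ s) (inRight ch) y≢c = right⊑ (⊑-parent s ch (λ e → y≢c (cong right e)))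

  child⋢parent : ∀ {β} {z c : Pos β} → Child z c → ¬ (c ⊑ z)
  child⋢parent toLeft ()
  child⋢parent toRight ()
  child⋢parent (inLeft ch) (left⊑ s) = child⋢parent ch s
  child⋢parent (inRight ch) (right⊑ s) = child⋢parent ch s

  enter-subtree : ∀ {β} {c y z : Pos β} → Child y z → ¬ (c ⊑ y) → c ⊑ z → z ≡ c
  enter-subtree {c = c} {z = z} ch c⋢y c⊑z with z ≟ₚ c
  ... | yes z≡c = z≡c
  ... | no z≢c = ⊥-elim (c⋢y (⊑-parent c⊑z ch z≢c))

  Between : ∀ {β} → Pos β → Pos β → Pos β → Pos β → Set
  Between c q a a' = Child a a' × c ⊑ a × a' ⊑ q

  descend : ∀ {β} {c q : Pos β} → c ⊑ q → Star (Between c q) c q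
  descend {q = q} root⊑ = fromRoot q
    where
    fromRoot : ∀ {γ} (q : Pos γ) → Star (Between root q) root q
    fromRoot root = ε
    fromRoot (left q) = (toLeft , root⊑ , left⊑ root⊑) ◅ gmap left (λ { (ch , _ , a'⊑q) → inLeft ch , root⊑ , left⊑ a'⊑q }) (fromRoot q)
    fromRoot (right q) = (toRight , root⊑ , right⊑ root⊑) ◅ gmap right (λ { (ch , _ , a'⊑q) → inRight ch , root⊑ , right⊑ a'⊑q }) (fromRoot q)
  descend (left⊑ s) = gmap left (λ { (ch , c⊑a , a'⊑q) → inLeft ch , left⊑ c⊑a , left⊑ a'⊑q }) (descend s)
  descend (right⊑ s) = gmap right (λ { (ch , c⊑a , a'⊑q) → inRight ch , right⊑ c⊑a , right⊑ a'⊑q }) (descend s)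

  children : ∀ {β} → Pos β → List (Pos β)
  children {leaf v} root = []
  children {node l r} root = left root ∷ right root ∷ []
  children (left p) = map left (children p)
  children (right p) = map right (children p)

  parents : ∀ {β} → Pos β → List (Pos β)
  parents root = []
  parents (left root) = root ∷ []
  parents (left (left p)) = map left (parents (left p))
  parents (left (right p)) = map left (parents (right p))
  parents (right root) = root ∷ []
  parents (right (left p)) = map right (parents (left p))
  parents (right (right p)) = map right (parents (right p))

  Child⇒∈children : ∀ {β} {p q : Pos β} → Child p q → q ∈ₗ children p
  Child⇒∈children toLeft = here refl
  Child⇒∈children toRight = there (here refl)
  Child⇒∈children (inLeft c) = ∈-map⁺ left (Child⇒∈children c)
  Child⇒∈children (inRight c) = ∈-map⁺ right (Child⇒∈children c)

  Child⇒∈parents : ∀ {β} {p q : Pos β} → Child q p → q ∈ₗ parents p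
  Child⇒∈parents toLeft = here refl
  Child⇒∈parents toRight = here refl
  Child⇒∈parents (inLeft {q = left q} c) = ∈-map⁺ left (Child⇒∈parents c)
  Child⇒∈parents (inLeft {q = right q} c) = ∈-map⁺ left (Child⇒∈parents c)
  Child⇒∈parents (inRight {q = left q} c) = ∈-map⁺ right (Child⇒∈parents c)
  Child⇒∈parents (inRight {q = right q} c) = ∈-map⁺ right (Child⇒∈parents c)
  Child⇒∈parents (inLeft {q = root} ())
  Child⇒∈parents (inRight {q = root} ())

  length-children : ∀ {β} (p : Pos β) → length (children p) ≤ 2
  length-children {leaf v} root = z≤n
  length-children {node l r} root = s≤s (s≤s z≤n)
  length-children (left p) = subst (_≤ 2) (sym (length-map left (children p))) (length-children p)
  length-children (right p) = subst (_≤ 2) (sym (length-map right (children p))) (length-children p)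

  length-parents : ∀ {β} (p : Pos β) → length (parents p) ≤ 1
  length-parents root = z≤n
  length-parents (left root) = s≤s z≤n
  length-parents (left (left p)) = subst (_≤ 1) (sym (length-map left (parents (left p)))) (length-parents (left p))
  length-parents (left (right p)) = subst (_≤ 1) (sym (length-map left (parents (right p)))) (length-parents (right p))
  length-parents (right root) = s≤s z≤n
  length-parents (right (left p)) = subst (_≤ 1) (sym (length-map right (parents (left p)))) (length-parents (left p))
  length-parents (right (right p)) = subst (_≤ 1) (sym (length-map right (parents (right p)))) (length-parents (right p))

  data IsLeafPos : {β : BinTree} → Pos β → Set where
    atLeaf : ∀ {v} → IsLeafPos {leaf v} root
    inLeft : ∀ {l r} {p : Pos l} → IsLeafPos p → IsLeafPos {node l r} (left p)
    inRight : ∀ {l r} {p : Pos r} → IsLeafPos p → IsLeafPos {node l r} (right p)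

  IsLeafPos? : ∀ {β} (p : Pos β) → Dec (IsLeafPos p)
  IsLeafPos? {leaf v} root = yes atLeaf
  IsLeafPos? {node l r} root = no (λ ())
  IsLeafPos? (left p) = map′ inLeft (λ { (inLeft a) → a }) (IsLeafPos? p)
  IsLeafPos? (right p) = map′ inRight (λ { (inRight a) → a }) (IsLeafPos? p)

  inner⇒two-children : ∀ {β} (p : Pos β) → ¬ IsLeafPos p → ∃ λ a → ∃ λ c → Child p a × Child p c × a ≢ c
  inner⇒two-children {leaf v} root ¬leaf = ⊥-elim (¬leaf atLeaf)
  inner⇒two-children {node l r} root ¬leaf = left root , right root , toLeft , toRight , (λ ())
  inner⇒two-children (left p) ¬leaf with inner⇒two-children p (λ q → ¬leaf (inLeft q))
  ... | a , c , ca , cc , a≢c = left a , left c , inLeft ca , inLeft cc , (λ e → a≢c (left-injective e))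
  inner⇒two-children (right p) ¬leaf with inner⇒two-children p (λ q → ¬leaf (inRight q))
  ... | a , c , ca , cc , a≢c = right a , right c , inRight ca , inRight cc , (λ e → a≢c (right-injective e))

  leaf⇒no-child : ∀ {β} {p q : Pos β} → IsLeafPos p → ¬ Child p q
  leaf⇒no-child (inLeft lp) (inLeft c) = leaf⇒no-child lp c
  leaf⇒no-child (inRight lp) (inRight c) = leaf⇒no-child lp c

  -- At a leaf position this is the vertex stored there; elsewhere it is the leftmost leaf below.
  vertexAt : ∀ {β} → Pos β → Fin n
  vertexAt {leaf v} root = v
  vertexAt {node l r} root = vertexAt {l} root
  vertexAt (left p) = vertexAt p
  vertexAt (right p) = vertexAt p

  vertexAt∈leaves : ∀ {β} (p : Pos β) → vertexAt p ∈ leaves β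
  vertexAt∈leaves {leaf v} root = x∈⁅x⁆ v
  vertexAt∈leaves {node l r} root = x∈p∪q⁺ (inj₁ (vertexAt∈leaves {l} root))
  vertexAt∈leaves (left p) = x∈p∪q⁺ (inj₁ (vertexAt∈leaves p))
  vertexAt∈leaves (right p) = x∈p∪q⁺ (inj₂ (vertexAt∈leaves p))

  leafPos : ∀ β v → v ∈ leaves β → Σ (Pos β) λ p → IsLeafPos p × vertexAt p ≡ v
  leafPos (leaf w) v v∈ = root , atLeaf , sym (x∈⁅y⁆⇒x≡y w v∈)
  leafPos (node l r) v v∈ with x∈p∪q⁻ (leaves l) (leaves r) v∈
  ... | inj₁ v∈l with leafPos l v v∈l
  ... | p , lp , e = left p , inLeft lp , e
  leafPos (node l r) v v∈ | inj₂ v∈r with leafPos r v v∈r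
  ... | p , lp , e = right p , inRight lp , e

  leafPos-unique : ∀ {β} → DistinctLeaves β → {p q : Pos β} → IsLeafPos p → IsLeafPos q → vertexAt p ≡ vertexAt q → p ≡ q
  leafPos-unique _ atLeaf atLeaf _ = refl
  leafPos-unique (dl , _ , _) (inLeft a) (inLeft c) e = cong left (leafPos-unique dl a c e)
  leafPos-unique (_ , dr , _) (inRight a) (inRight c) e = cong right (leafPos-unique dr a c e)
  leafPos-unique (_ , _ , disj) (inLeft {p = p} a) (inRight {p = q} c) e =
    ⊥-elim (disj _ (vertexAt∈leaves p) (subst (_∈ _) (sym e) (vertexAt∈leaves q)))
  leafPos-unique (_ , _ , disj) (inRight {p = p} a) (inLeft {p = q} c) e =
    ⊥-elim (disj _ (vertexAt∈leaves q) (subst (_∈ _) e (vertexAt∈leaves p)))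

  subtreeAt : ∀ β → Pos β → BinTree
  subtreeAt β root = β
  subtreeAt (node l r) (left p) = subtreeAt l p
  subtreeAt (node l r) (right p) = subtreeAt r p

  subtreeAt⊆ : ∀ β (c : Pos β) {x} → x ∈ leaves (subtreeAt β c) → x ∈ leaves β
  subtreeAt⊆ β root x∈ = x∈
  subtreeAt⊆ (node l r) (left c) x∈ = x∈p∪q⁺ (inj₁ (subtreeAt⊆ l c x∈))
  subtreeAt⊆ (node l r) (right c) x∈ = x∈p∪q⁺ (inj₂ (subtreeAt⊆ r c x∈))

  ⊑⇒∈subtreeAt : ∀ {β} {c q : Pos β} → c ⊑ q → vertexAt q ∈ leaves (subtreeAt β c)
  ⊑⇒∈subtreeAt {q = q} root⊑ = vertexAt∈leaves q
  ⊑⇒∈subtreeAt (left⊑ s) = ⊑⇒∈subtreeAt s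
  ⊑⇒∈subtreeAt (right⊑ s) = ⊑⇒∈subtreeAt s

  ∈subtreeAt⇒⊑ : ∀ {β} → DistinctLeaves β → (c q : Pos β) → IsLeafPos q → vertexAt q ∈ leaves (subtreeAt β c) → c ⊑ q
  ∈subtreeAt⇒⊑ _ root q _ _ = root⊑
  ∈subtreeAt⇒⊑ (dl , _ , _) (left c) (left q) (inLeft lq) x∈ = left⊑ (∈subtreeAt⇒⊑ dl c q lq x∈)
  ∈subtreeAt⇒⊑ (_ , dr , _) (right c) (right q) (inRight lq) x∈ = right⊑ (∈subtreeAt⇒⊑ dr c q lq x∈)
  ∈subtreeAt⇒⊑ {node l r} (_ , _ , disj) (left c) (right q) (inRight lq) x∈ = ⊥-elim (disj _ (subtreeAt⊆ l c x∈) (vertexAt∈leaves q))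
  ∈subtreeAt⇒⊑ {node l r} (_ , _ , disj) (right c) (left q) (inLeft lq) x∈ = ⊥-elim (disj _ (vertexAt∈leaves q) (subtreeAt⊆ r c x∈))

  AllSubtrees-at : ∀ {Q : Subset n → Set} β → AllSubtrees Q β → ∀ c → Q (leaves (subtreeAt β c))
  AllSubtrees-at (leaf v) q root = q
  AllSubtrees-at (node l r) (q , _) root = q
  AllSubtrees-at (node l r) (_ , ql , _) (left c) = AllSubtrees-at l ql c
  AllSubtrees-at (node l r) (_ , _ , qr) (right c) = AllSubtrees-at r qr c

-- From tree decompositions to branch decompositions

module _ {n : ℕ} where

  leaves? : Maybe (BinTree {n}) → Subset n
  leaves? nothing = ∅
  leaves? (just β) = leaves β

  DistinctLeaves? : Maybe (BinTree {n}) → Set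
  DistinctLeaves? nothing = Unit
  DistinctLeaves? (just β) = DistinctLeaves β

  AllSubtrees? : (Subset n → Set) → Maybe (BinTree {n}) → Set
  AllSubtrees? Q nothing = Unit
  AllSubtrees? Q (just β) = AllSubtrees Q β

  merge : Maybe (BinTree {n}) → Maybe (BinTree {n}) → Maybe (BinTree {n})
  merge nothing β? = β?
  merge (just β) nothing = just β
  merge (just β) (just γ) = just (node β γ)

  record Merged (Q : Subset n → Set) (β? γ? : Maybe (BinTree {n})) : Set where
    field
      distinct : DistinctLeaves? (merge β? γ?)
      all : AllSubtrees? Q (merge β? γ?)
      ∈⁻ : ∀ x → x ∈ leaves? (merge β? γ?) → x ∈ leaves? β? ⊎ x ∈ leaves? γ?
      ∈⁺ : ∀ x → x ∈ leaves? β? ⊎ x ∈ leaves? γ? → x ∈ leaves? (merge β? γ?)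

  merge-ok : ∀ {Q} β? γ? → DistinctLeaves? β? → DistinctLeaves? γ? → AllSubtrees? Q β? → AllSubtrees? Q γ? →
             (∀ x → x ∈ leaves? β? → x ∉ leaves? γ?) → Q (leaves? β? ∪ leaves? γ?) → Merged Q β? γ?
  merge-ok nothing γ? _ dγ _ qγ _ _ = record
    { distinct = dγ ; all = qγ ; ∈⁻ = λ x x∈ → inj₂ x∈ ; ∈⁺ = λ { x (inj₁ x∈) → ⊥-elim (∉⊥ x∈) ; x (inj₂ x∈) → x∈ } }
  merge-ok (just β) nothing dβ _ qβ _ _ _ = record
    { distinct = dβ ; all = qβ ; ∈⁻ = λ x x∈ → inj₁ x∈ ; ∈⁺ = λ { x (inj₁ x∈) → x∈ ; x (inj₂ x∈) → ⊥-elim (∉⊥ x∈) } }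
  merge-ok (just β) (just γ) dβ dγ qβ qγ disj q = record
    { distinct = dβ , dγ , disj ; all = q , qβ , qγ ; ∈⁻ = λ x x∈ → x∈p∪q⁻ _ _ x∈ ; ∈⁺ = λ x x∈ → x∈p∪q⁺ x∈ }

module FromTreeDecomposition {n : ℕ} {G : Graph n} {b : ℕ} (TD : TreeDecomposition G b) where

  open TreeDecomposition TD
  open RootedTree T (proj₂ isTree)

  home : Fin n → Fin m
  home v = proj₁ (covV v)

  ∈bag-home : ∀ v → v ∈ bag (home v)
  ∈bag-home v = proj₂ (covV v)

  BoundaryInBag : Subset n → Set
  BoundaryInBag A = ∃ λ s → ∀ x y → x ∈ A → y ∉ A → E G x y → x ∈ bag s ⊎ y ∈ bag s

  HomedBelow : Fin m → List (Fin m) → Set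
  HomedBelow t ps = Σ (Maybe (BinTree {n})) λ β? → DistinctLeaves? β? × AllSubtrees? BoundaryInBag β? ×
    (∀ v → (v ∈ leaves? β? → Reach (TminusParent t ps) t (home v)) × (Reach (TminusParent t ps) t (home v) → v ∈ leaves? β?))

  leave-branch⇒∈bag : ∀ {w t v a c} → Reach (TminusEdge T w t) w a → ¬ Reach (TminusEdge T w t) w c →
                      Reach (λ x y → E T x y × v ∈ bag x × v ∈ bag y) a c → v ∈ bag t
  leave-branch⇒∈bag w↝a w↝̸c here = ⊥-elim (w↝̸c w↝a)
  leave-branch⇒∈bag {t = t} {a = a} w↝a w↝̸c (step {y = a'} (e , v∈a , v∈a') rest) with a ≟ t | a' ≟ t
  ... | yes refl | _ = v∈a
  ... | no _ | yes refl = v∈a'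
  ... | no a≢t | no a'≢t =
    leave-branch⇒∈bag (Reach-snoc w↝a (e , (λ { (_ , a'≡t) → a'≢t a'≡t }) , (λ { (a≡t , _) → a≢t a≡t }))) w↝̸c rest

  module Step (t : Fin m) (ps : List (Fin m)) (rp : RootPath t ps)
              (rec : ∀ w → E T t w → NotParent w ps → HomedBelow w (t ∷ ps)) where

    BranchClosed : Subset n → Set
    BranchClosed U = ∀ x → x ∈ U → home x ≢ t →
      ∃ λ w → E T t w × NotParent w ps × Reach (TminusEdge T w t) w (home x) ×
              (∀ y → Reach (TminusEdge T w t) w (home y) → y ∈ U)

    -- The edge xy lies in some bag s. If s is in the branch containing home x, the bags containing y
    -- lead from s out of that branch; otherwise those containing x lead into s. Either way through t.
    BranchClosed⇒BoundaryInBag : ∀ U → BranchClosed U → BoundaryInBag U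
    BranchClosed⇒BoundaryInBag U closed = t , covered
      where
      covered : ∀ x y → x ∈ U → y ∉ U → E G x y → x ∈ bag t ⊎ y ∈ bag t
      covered x y x∈U y∉U e with home x ≟ t | home y ≟ t
      ... | yes hx | _ = inj₁ (subst (λ s → x ∈ bag s) hx (∈bag-home x))
      ... | no _ | yes hy = inj₂ (subst (λ s → y ∈ bag s) hy (∈bag-home y))
      ... | no hx | no _ with closed x x∈U hx | covE x y e
      ... | w , ew , w≢p , w↝x , branch⊆U | s , x∈s , y∈s with reach? w (t ∷ ps) (RootPath-child rp ew w≢p) s
      ... | yes w↝s = inj₂ (leave-branch⇒∈bag w↝s (λ w↝y → y∉U (branch⊆U y w↝y)) (subtree y s (home y) y∈s (∈bag-home y)))
      ... | no w↝̸s = inj₁ (leave-branch⇒∈bag w↝x w↝̸s (subtree x (home x) s (∈bag-home x) x∈s))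

    homed : List (Fin n)
    homed = filter (λ v → home v ≟ t) (allFin n)

    homedTree : List (Fin n) → Maybe (BinTree {n})
    homedTree [] = nothing
    homedTree (v ∷ vs) = merge (homedTree vs) (just (leaf v))

    homedTree-ok : ∀ vs → Unique vs → (∀ {v} → v ∈ₗ vs → home v ≡ t) →
                   DistinctLeaves? (homedTree vs) × AllSubtrees? BoundaryInBag (homedTree vs) ×
                   (∀ x → x ∈ leaves? (homedTree vs) → x ∈ₗ vs) × (∀ x → x ∈ₗ vs → x ∈ leaves? (homedTree vs))
    homedTree-ok [] _ _ = tt , tt , (λ x x∈ → ⊥-elim (∉⊥ x∈)) , (λ x ())
    homedTree-ok (v ∷ vs) (v∉vs ∷ u) homed-vs with homedTree-ok vs u (λ x∈ → homed-vs (there x∈))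
    ... | dvs , avs , ⊆vs , vs⊆ = M.distinct , M.all , ⊆v∷vs , v∷vs⊆
      where
      all-homed : ∀ U → (∀ x → x ∈ U → home x ≡ t) → BranchClosed U
      all-homed U homed-U x x∈U hx = ⊥-elim (hx (homed-U x x∈U))
      disj : ∀ x → x ∈ leaves? (homedTree vs) → x ∉ ⁅ v ⁆
      disj x x∈vs x∈v with x∈⁅y⁆⇒x≡y v x∈v
      ... | refl = Unique.Unique[x∷xs]⇒x∉xs (v∉vs ∷ u) (⊆vs x x∈vs)
      homed-∪ : ∀ x → x ∈ leaves? (homedTree vs) ∪ ⁅ v ⁆ → home x ≡ t
      homed-∪ x x∈ with x∈p∪q⁻ _ _ x∈
      ... | inj₁ x∈vs = homed-vs (there (⊆vs x x∈vs))
      ... | inj₂ x∈v rewrite x∈⁅y⁆⇒x≡y v x∈v = homed-vs (here refl)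
      homed-v : ∀ x → x ∈ ⁅ v ⁆ → home x ≡ t
      homed-v x x∈v rewrite x∈⁅y⁆⇒x≡y v x∈v = homed-vs (here refl)
      module M = Merged (merge-ok (homedTree vs) (just (leaf v)) dvs tt avs
                   (BranchClosed⇒BoundaryInBag _ (all-homed _ homed-v))
                   disj (BranchClosed⇒BoundaryInBag _ (all-homed _ homed-∪)))
      ⊆v∷vs : ∀ x → x ∈ leaves? (homedTree (v ∷ vs)) → x ∈ₗ (v ∷ vs)
      ⊆v∷vs x x∈ with M.∈⁻ x x∈
      ... | inj₁ x∈vs = there (⊆vs x x∈vs)
      ... | inj₂ x∈v = here (x∈⁅y⁆⇒x≡y v x∈v)
      v∷vs⊆ : ∀ x → x ∈ₗ (v ∷ vs) → x ∈ leaves? (homedTree (v ∷ vs))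
      v∷vs⊆ x (here refl) = M.∈⁺ x (inj₂ (x∈⁅x⁆ x))
      v∷vs⊆ x (there x∈) = M.∈⁺ x (inj₁ (vs⊆ x x∈))

    IsChild : Fin m → Set
    IsChild w = E T t w × NotParent w ps

    IsChild? : ∀ w → Dec (IsChild w)
    IsChild? w = E? T t w ×-dec NotParent? w ps

    childList : List (Fin m)
    childList = filter IsChild? (allFin m)

    childrenTree : (ws : List (Fin m)) → (∀ {w} → w ∈ₗ ws → IsChild w) → Maybe (BinTree {n})
    childrenTree [] _ = homedTree homed
    childrenTree (w ∷ ws) ch = merge (childrenTree ws (λ w∈ → ch (there w∈)))
                                     (proj₁ (rec w (proj₁ (ch (here refl))) (proj₂ (ch (here refl)))))

    Covered : List (Fin m) → Fin n → Set
    Covered ws x = home x ≡ t ⊎ ∃ λ w → w ∈ₗ ws × Reach (TminusEdge T w t) w (home x)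

    childrenTree-ok : ∀ ws (ch : ∀ {w} → w ∈ₗ ws → IsChild w) → Unique ws →
                      DistinctLeaves? (childrenTree ws ch) × AllSubtrees? BoundaryInBag (childrenTree ws ch) ×
                      (∀ x → x ∈ leaves? (childrenTree ws ch) → Covered ws x) ×
                      (∀ x → Covered ws x → x ∈ leaves? (childrenTree ws ch))
    childrenTree-ok [] _ _ with homedTree-ok homed (Unique.filter⁺ (λ v → home v ≟ t) (Unique.allFin⁺ n))
                                  (λ v∈ → proj₂ (∈-filter⁻ (λ v → home v ≟ t) {xs = allFin n} v∈))
    ... | d , a , ⊆homed , homed⊆ =
      d , a , (λ x x∈ → inj₁ (proj₂ (∈-filter⁻ (λ v → home v ≟ t) {xs = allFin n} (⊆homed x x∈)))) ,
      (λ { x (inj₁ hx) → homed⊆ x (∈-filter⁺ (λ v → home v ≟ t) (∈-allFin x) hx) ; x (inj₂ (_ , () , _)) })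
    childrenTree-ok (w ∷ ws) ch (w∉ws ∷ u) with childrenTree-ok ws (λ w∈ → ch (there w∈)) u
    ... | dws , aws , ⊆ws , ws⊆ = M.distinct , M.all , ⊆w∷ws , w∷ws⊆
      where
      ew : E T t w
      ew = proj₁ (ch (here refl))
      w≢p : NotParent w ps
      w≢p = proj₂ (ch (here refl))
      β? : Maybe (BinTree {n})
      β? = proj₁ (rec w ew w≢p)
      dβ : DistinctLeaves? β?
      dβ = proj₁ (proj₂ (rec w ew w≢p))
      aβ : AllSubtrees? BoundaryInBag β?
      aβ = proj₁ (proj₂ (proj₂ (rec w ew w≢p)))
      β?-spec : ∀ v → (v ∈ leaves? β? → Reach (TminusEdge T w t) w (home v)) × (Reach (TminusEdge T w t) w (home v) → v ∈ leaves? β?)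
      β?-spec = proj₂ (proj₂ (proj₂ (rec w ew w≢p)))
      disj : ∀ x → x ∈ leaves? (childrenTree ws (λ w∈ → ch (there w∈))) → x ∉ leaves? β?
      disj x x∈ws x∈β with ⊆ws x x∈ws
      ... | inj₁ hx = branch-excludes (E-sym T ew) (proj₁ (β?-spec x) x∈β) hx
      ... | inj₂ (w' , w'∈ , w'↝x) =
        branches-disjoint (proj₁ (ch (there w'∈))) ew (λ w'≡w → Unique.Unique[x∷xs]⇒x∉xs (w∉ws ∷ u) (subst (_∈ₗ ws) w'≡w w'∈))
                          w'↝x (proj₁ (β?-spec x) x∈β)
      U : Subset n
      U = leaves? (childrenTree ws (λ w∈ → ch (there w∈))) ∪ leaves? β?
      closed : BranchClosed U
      closed x x∈U hx with x∈p∪q⁻ _ _ x∈U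
      ... | inj₂ x∈β = w , ew , w≢p , proj₁ (β?-spec x) x∈β , (λ y w↝y → x∈p∪q⁺ (inj₂ (proj₂ (β?-spec y) w↝y)))
      ... | inj₁ x∈ws with ⊆ws x x∈ws
      ... | inj₁ hx' = ⊥-elim (hx hx')
      ... | inj₂ (w' , w'∈ , w'↝x) = w' , proj₁ (ch (there w'∈)) , proj₂ (ch (there w'∈)) , w'↝x ,
                                     (λ y w'↝y → x∈p∪q⁺ (inj₁ (ws⊆ y (inj₂ (w' , w'∈ , w'↝y)))))
      module M = Merged (merge-ok (childrenTree ws (λ w∈ → ch (there w∈))) β? dws dβ aws aβ disj
                                  (BranchClosed⇒BoundaryInBag U closed))
      ⊆w∷ws : ∀ x → x ∈ leaves? (childrenTree (w ∷ ws) ch) → Covered (w ∷ ws) x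
      ⊆w∷ws x x∈ with M.∈⁻ x x∈
      ... | inj₂ x∈β = inj₂ (w , here refl , proj₁ (β?-spec x) x∈β)
      ... | inj₁ x∈ws with ⊆ws x x∈ws
      ... | inj₁ hx = inj₁ hx
      ... | inj₂ (w' , w'∈ , w'↝x) = inj₂ (w' , there w'∈ , w'↝x)
      w∷ws⊆ : ∀ x → Covered (w ∷ ws) x → x ∈ leaves? (childrenTree (w ∷ ws) ch)
      w∷ws⊆ x (inj₁ hx) = M.∈⁺ x (inj₁ (ws⊆ x (inj₁ hx)))
      w∷ws⊆ x (inj₂ (_ , here refl , w↝x)) = M.∈⁺ x (inj₂ (proj₂ (β?-spec x) w↝x))
      w∷ws⊆ x (inj₂ (w' , there w'∈ , w'↝x)) = M.∈⁺ x (inj₁ (ws⊆ x (inj₂ (w' , w'∈ , w'↝x))))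

    childList-ok : ∀ {w} → w ∈ₗ childList → IsChild w
    childList-ok w∈ = proj₂ (∈-filter⁻ IsChild? {xs = allFin m} w∈)

    homedBelow : HomedBelow t ps
    homedBelow with childrenTree-ok childList childList-ok (Unique.filter⁺ IsChild? (Unique.allFin⁺ m))
    ... | d , a , ⊆cov , cov⊆ =
      childrenTree childList childList-ok , d , a ,
      λ v → (λ v∈ → InSubtree⇒Reach (toInSubtree v (⊆cov v v∈))) , (λ t↝v → cov⊆ v (fromInSubtree v (Reach⇒InSubtree t↝v)))
      where
      toInSubtree : ∀ v → Covered childList v → InSubtree t ps (home v)
      toInSubtree v (inj₁ hv) = inj₁ hv
      toInSubtree v (inj₂ (w , w∈ , w↝v)) = inj₂ (w , proj₁ (childList-ok w∈) , proj₂ (childList-ok w∈) , w↝v)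
      fromInSubtree : ∀ v → InSubtree t ps (home v) → Covered childList v
      fromInSubtree v (inj₁ hv) = inj₁ hv
      fromInSubtree v (inj₂ (w , e , w≢p , w↝v)) = inj₂ (w , ∈-filter⁺ IsChild? (∈-allFin w) (e , w≢p) , w↝v)

  binTree : Fin n → Σ (BinTree {n}) λ β → DistinctLeaves β × AllSubtrees BoundaryInBag β × (∀ v → v ∈ leaves β)
  binTree v₀ with rootedRec HomedBelow (λ t ps rp rec → Step.homedBelow t ps rp rec) (home v₀) [] ([-] , [] ∷ [])
  ... | nothing , _ , _ , spec = ⊥-elim (∉⊥ (proj₂ (spec v₀) (proj₁ isTree _ _)))
  ... | just β , d , a , spec = β , d , a , λ v → proj₂ (spec v) (proj₁ isTree (home v₀) (home v))

module _ {n : ℕ} where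

  #nonRoot : BinTree {n} → ℕ
  #nonRoot (leaf _) = 0
  #nonRoot (node l r) = suc (#nonRoot l) + suc (#nonRoot r)

  #Pos : BinTree {n} → ℕ
  #Pos γ = suc (#nonRoot γ)

  encode : ∀ {γ} → Pos γ → Fin (#Pos γ)
  encode root = zero
  encode {node l r} (left p) = suc (encode p ↑ˡ #Pos r)
  encode {node l r} (right p) = suc (#Pos l ↑ʳ encode p)

  decode : ∀ {γ} → Fin (#Pos γ) → Pos γ
  decode zero = root
  decode {node l r} (suc i) = [ (λ a → left (decode a)) , (λ c → right (decode c)) ]′ (splitAt (#Pos l) i)

  decode-encode : ∀ {γ} (p : Pos γ) → decode (encode p) ≡ p
  decode-encode root = refl
  decode-encode {node l r} (left p) rewrite splitAt-↑ˡ (#Pos l) (encode p) (#Pos r) = cong left (decode-encode p)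
  decode-encode {node l r} (right p) rewrite splitAt-↑ʳ (#Pos l) (#Pos r) (encode p) = cong right (decode-encode p)

  encode-decode : ∀ {γ} (i : Fin (#Pos γ)) → encode (decode {γ} i) ≡ i
  encode-decode zero = refl
  encode-decode {node l r} (suc i) with splitAt (#Pos l) i in eq
  ... | inj₁ a = cong suc (trans (cong (_↑ˡ #Pos r) (encode-decode a)) (splitAt⁻¹-↑ˡ eq))
  ... | inj₂ c = cong suc (trans (cong (#Pos l ↑ʳ_) (encode-decode c)) (splitAt⁻¹-↑ʳ eq))

module ToBranchDecomposition {n : ℕ} (G : Graph n) (β : BinTree {n}) (distinct : DistinctLeaves β)
                             (all : ∀ v → v ∈ leaves β) where

  m : ℕ
  m = #Pos β

  P : Set
  P = Pos β

  decode-injective : ∀ {x y : Fin m} → decode {γ = β} x ≡ decode y → x ≡ y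
  decode-injective {x} {y} e = trans (sym (encode-decode x)) (trans (cong encode e) (encode-decode y))

  pos : Fin m → P
  pos = decode

  isChild : Fin m → Fin m → Bool
  isChild x y = does (Child? (pos x) (pos y))

  T : Graph m
  T = record
    { adj = λ x y → isChild x y ∨ isChild y x
    ; sym = λ x y → Bool.∨-comm (isChild x y) (isChild y x)
    ; irrefl = λ x → cong (λ b → b ∨ b) (dec-false (Child? (pos x) (pos x)) Child-irrefl)
    }

  E⇒Child : ∀ x y → E T x y → Child (pos x) (pos y) ⊎ Child (pos y) (pos x)
  E⇒Child x y e with Child? (pos x) (pos y) | Child? (pos y) (pos x)
  ... | yes c | _ = inj₁ c
  ... | no _ | yes c = inj₂ c
  ... | no _ | no _ with e
  ... | ()

  Child⇒E : ∀ x y → Child (pos x) (pos y) ⊎ Child (pos y) (pos x) → E T x y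
  Child⇒E x y c with Child? (pos x) (pos y) | Child? (pos y) (pos x)
  ... | yes _ | _ = refl
  ... | no _ | yes _ = refl
  ... | no ¬xy | no ¬yx = ⊥-elim ([ ¬xy , ¬yx ]′ c)

  pos-encode : ∀ {a : P} {Q : P → Set} → Q a → Q (pos (encode a))
  pos-encode {a} {Q} q = subst Q (sym (decode-encode a)) q

  Child⇒E-down : ∀ {a a' : P} → Child a a' → E T (encode a) (encode a')
  Child⇒E-down {a} {a'} c = Child⇒E (encode a) (encode a') (inj₁ (subst₂ Child (sym (decode-encode a)) (sym (decode-encode a')) c))

  Child⇒E-up : ∀ {a a' : P} → Child a' a → E T (encode a) (encode a')
  Child⇒E-up {a} {a'} c = E-sym T {encode a'} {encode a} (Child⇒E-down c)

  Star⇒Reach-T : ∀ {S : P → P → Set} {R : Fin m → Fin m → Set} → (∀ {a b} → S a b → R (encode a) (encode b)) →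
                 ∀ {x y} → Star S (pos x) (pos y) → Reach R x y
  Star⇒Reach-T {R = R} f {x} {y} w = subst₂ (Reach R) (encode-decode x) (encode-decode y) (Star⇒Reach encode f w)

  T-connected : Connected T
  T-connected x y = Reach-trans (Star⇒Reach-T (λ { (c , _) → Child⇒E-up c }) {x} {zero} (reverse (λ s → s) (descend {q = pos x} root⊑)))
                                (Star⇒Reach-T (λ { (c , _) → Child⇒E-down c }) (descend {q = pos y} root⊑))

  encode≢ : ∀ {a : P} {u : Fin m} → ¬ (pos u ⊑ a) → encode a ≢ u
  encode≢ {a} u⋢a refl = u⋢a (pos-encode {Q = _⊑ a} ⊑-refl)

  childSide⇒⊑ : ∀ {t u} → Child (pos u) (pos t) → ∀ {x} → Reach (TminusEdge T t u) t x → pos t ⊑ pos x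
  childSide⇒⊑ {t} {u} u→t = go ⊑-refl
    where
    go : ∀ {y x} → pos t ⊑ pos y → Reach (TminusEdge T t u) y x → pos t ⊑ pos x
    go t⊑y here = t⊑y
    go {y} t⊑y (step {y = z} (e , ¬tu , _) w) with E⇒Child y z e
    ... | inj₁ y→z = go (⊑-child t⊑y y→z) w
    ... | inj₂ z→y with pos y ≟ₚ pos t
    ... | yes y≡t = ⊥-elim (¬tu (decode-injective y≡t , decode-injective (parent-unique (subst (Child (pos z)) y≡t z→y) u→t)))
    ... | no y≢t = go (⊑-parent t⊑y z→y y≢t) w

  ⊑⇒childSide : ∀ {t u} → Child (pos u) (pos t) → ∀ {x} → pos t ⊑ pos x → Reach (TminusEdge T t u) t x
  ⊑⇒childSide {t} {u} u→t t⊑x = Star⇒Reach-T inside (descend t⊑x)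
    where
    avoid : ∀ {a} → pos t ⊑ a → encode a ≢ u
    avoid t⊑a refl = child⋢parent u→t (pos-encode {Q = pos t ⊑_} t⊑a)
    inside : ∀ {q a b} → Between (pos t) q a b → TminusEdge T t u (encode a) (encode b)
    inside (c , t⊑a , _) = Child⇒E-down c , (λ { (_ , b≡u) → avoid (⊑-child t⊑a c) b≡u }) , (λ { (a≡u , _) → avoid t⊑a a≡u })

  parentSide⇒⋢ : ∀ {t u} → Child (pos t) (pos u) → ∀ {x} → Reach (TminusEdge T t u) t x → ¬ (pos u ⊑ pos x)
  parentSide⇒⋢ {t} {u} t→u = go (child⋢parent t→u)
    where
    go : ∀ {y x} → ¬ (pos u ⊑ pos y) → Reach (TminusEdge T t u) y x → ¬ (pos u ⊑ pos x)
    go u⋢y here = u⋢y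
    go {y} u⋢y (step {y = z} (e , ¬tu , _) w) = go u⋢z w
      where
      u⋢z : ¬ (pos u ⊑ pos z)
      u⋢z u⊑z with E⇒Child y z e
      ... | inj₂ z→y = u⋢y (⊑-child u⊑z z→y)
      ... | inj₁ y→z with enter-subtree y→z u⋢y u⊑z
      ... | z≡u = ¬tu (decode-injective (parent-unique y→z (subst (Child (pos t)) (sym z≡u) t→u)) , decode-injective z≡u)

  ⋢⇒parentSide : ∀ {t u} → Child (pos t) (pos u) → ∀ {x} → ¬ (pos u ⊑ pos x) → Reach (TminusEdge T t u) t x
  ⋢⇒parentSide {t} {u} t→u {x} u⋢x =
    Reach-trans (Star⇒Reach-T (λ s → TminusEdge-sym T (outside (child⋢parent t→u) s)) {t} {zero} (reverse (λ s → s) (descend {q = pos t} root⊑)))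
                (Star⇒Reach-T (outside u⋢x) (descend {q = pos x} root⊑))
    where
    outside : ∀ {q} → ¬ (pos u ⊑ q) → ∀ {a b} → Between root q a b → TminusEdge T t u (encode a) (encode b)
    outside u⋢q (c , _ , b⊑q) =
      Child⇒E-down c , (λ { (_ , b≡u) → encode≢ (λ u⊑b → u⋢q (⊑-trans u⊑b b⊑q)) b≡u })
                     , (λ { (a≡u , _) → encode≢ (λ u⊑a → u⋢q (⊑-trans u⊑a (⊑-trans (Child⇒⊑ c) b⊑q))) a≡u })

  -- A cycle x, y₁, …, yₖ with k ≥ 2 contains a walk from y₁ to x avoiding the edge y₁x.
  cycle⇒detour : ∀ {y₁ x} a zs → Linked (E T) (a ∷ zs ++ [ x ]) → a ≢ x → All (_≢ x) zs → All (y₁ ≢_) zs →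
                 (a ≡ y₁ → zs ≢ []) → Reach (TminusEdge T y₁ x) a x
  cycle⇒detour a [] (e ∷ [-]) a≢x _ _ short = step (e , (λ { (a≡y₁ , _) → short a≡y₁ refl }) , (λ { (a≡x , _) → a≢x a≡x })) here
  cycle⇒detour a (z ∷ zs) (e ∷ l) a≢x (z≢x ∷ zs≢x) (y₁≢z ∷ y₁≢zs) _ =
    step (e , (λ { (_ , z≡x) → z≢x z≡x }) , (λ { (a≡x , _) → a≢x a≡x }))
         (cycle⇒detour z zs l z≢x zs≢x y₁≢zs (λ z≡y₁ _ → y₁≢z (sym z≡y₁)))

  T-acyclic : Acyclic T
  T-acyclic x (y₁ ∷ []) (s≤s () , _)
  T-acyclic x (y₁ ∷ y₂ ∷ ys) (_ , ((x≢y₁ ∷ x≢ys) ∷ (y₁≢y₂ ∷ y₁≢ys) ∷ _) , (exy₁ ∷ l))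
    with cycle⇒detour y₁ (y₂ ∷ ys) l (λ e → x≢y₁ (sym e)) (flip-≢ x≢ys) (y₁≢y₂ ∷ y₁≢ys) (λ _ ())
    where
    flip-≢ : ∀ {zs} → All (x ≢_) zs → All (_≢ x) zs
    flip-≢ [] = []
    flip-≢ (p ∷ ps) = (λ e → p (sym e)) ∷ flip-≢ ps
  ... | detour with E⇒Child x y₁ exy₁
  ... | inj₁ x→y₁ = child⋢parent x→y₁ (childSide⇒⊑ x→y₁ detour)
  ... | inj₂ y₁→x = parentSide⇒⋢ y₁→x detour ⊑-refl

  neighbourList : Fin m → List (Fin m)
  neighbourList x = map encode (children (pos x) ++ parents (pos x))

  E⇒∈neighbourList : ∀ {x y} → E T x y → y ∈ₗ neighbourList x
  E⇒∈neighbourList {x} {y} e with E⇒Child x y e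
  ... | inj₁ c = subst (_∈ₗ neighbourList x) (encode-decode y) (∈-map⁺ encode (∈-++⁺ˡ (Child⇒∈children c)))
  ... | inj₂ c = subst (_∈ₗ neighbourList x) (encode-decode y) (∈-map⁺ encode (∈-++⁺ʳ (children (pos x)) (Child⇒∈parents c)))

  T-maxDegree≤3 : MaxDegree≤ T 3
  T-maxDegree≤3 x =
    ≤-trans (degree≤length T x (neighbourList x) (λ y → E⇒∈neighbourList {x} {y}))
            (subst (_≤ 3) (sym (trans (length-map encode (children (pos x) ++ parents (pos x))) (length-++ (children (pos x)))))
                   (+-mono-≤ (length-children (pos x)) (length-parents (pos x))))

  leafPos⇒IsLeaf : ∀ x → IsLeafPos (pos x) → IsLeaf T x
  leafPos⇒IsLeaf x leaf-x =
    ≤-trans (degree≤length T x (map encode (parents (pos x))) up)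
            (subst (_≤ 1) (sym (length-map encode (parents (pos x)))) (length-parents (pos x)))
    where
    up : ∀ y → E T x y → y ∈ₗ map encode (parents (pos x))
    up y e with E⇒Child x y e
    ... | inj₁ c = ⊥-elim (leaf⇒no-child leaf-x c)
    ... | inj₂ c = subst (_∈ₗ map encode (parents (pos x))) (encode-decode y) (∈-map⁺ encode (Child⇒∈parents c))

  IsLeaf⇒leafPos : ∀ x → IsLeaf T x → IsLeafPos (pos x)
  IsLeaf⇒leafPos x deg≤1 with IsLeafPos? (pos x)
  ... | yes leaf-x = leaf-x
  ... | no ¬leaf with inner⇒two-children (pos x) ¬leaf
  ... | a , c , x→a , x→c , a≢c with ≤-trans (2≤degree T x (toChild x→a) (toChild x→c) encode-a≢c) deg≤1
    where
    toChild : ∀ {z} → Child (pos x) z → E T x (encode z)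
    toChild {z} x→z = Child⇒E x (encode z) (inj₁ (subst (Child (pos x)) (sym (decode-encode z)) x→z))
    encode-a≢c : encode a ≢ encode c
    encode-a≢c e = a≢c (trans (sym (decode-encode a)) (trans (cong decode e) (decode-encode c)))
  ... | s≤s ()

  leafPosOf : ∀ v → Σ P λ p → IsLeafPos p × vertexAt p ≡ v
  leafPosOf v = leafPos β v (all v)

  δ : Σ (Fin m) (IsLeaf T) ↔ Fin n
  δ = mk↔ₛ′ vertexOf leafOf′ vertexOf-leafOf′ leafOf′-vertexOf
    where
    vertexOf : Σ (Fin m) (IsLeaf T) → Fin n
    vertexOf (x , _) = vertexAt (pos x)
    leafOf′ : Fin n → Σ (Fin m) (IsLeaf T)
    leafOf′ v = encode p , leafPos⇒IsLeaf (encode p) (pos-encode {Q = IsLeafPos} leaf-p)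
      where
      p : P
      p = proj₁ (leafPosOf v)
      leaf-p : IsLeafPos p
      leaf-p = proj₁ (proj₂ (leafPosOf v))
    vertexOf-leafOf′ : ∀ v → vertexOf (leafOf′ v) ≡ v
    vertexOf-leafOf′ v = trans (cong vertexAt (decode-encode (proj₁ (leafPosOf v)))) (proj₂ (proj₂ (leafPosOf v)))
    leafOf′-vertexOf : ∀ z → leafOf′ (vertexOf z) ≡ z
    leafOf′-vertexOf (x , leaf-x) = leaf-≡ (trans (cong encode p≡x) (encode-decode x))
      where
      p≡x : proj₁ (leafPosOf (vertexAt (pos x))) ≡ pos x
      p≡x = leafPos-unique distinct (proj₁ (proj₂ (leafPosOf _))) (IsLeaf⇒leafPos x leaf-x) (proj₂ (proj₂ (leafPosOf _)))
      leaf-≡ : ∀ {y} {leaf-y : IsLeaf T y} → y ≡ x → (y , leaf-y) ≡ (x , leaf-x)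
      leaf-≡ refl = cong (x ,_) (≤-irrelevant _ _)

  branchDecomposition : BranchDecomposition G
  branchDecomposition = record { m = m ; T = T ; isTree = T-connected , T-acyclic ; maxDeg3 = T-maxDegree≤3 ; δ = δ }

  open BranchDecomposition branchDecomposition using (IsCutOf)

  posOf : Fin n → P
  posOf v = proj₁ (leafPosOf v)

  ∈subtree⇒⊑posOf : ∀ c {v} → v ∈ leaves (subtreeAt β c) → c ⊑ pos (encode (posOf v))
  ∈subtree⇒⊑posOf c {v} v∈ = pos-encode {Q = c ⊑_}
    (∈subtreeAt⇒⊑ distinct c (posOf v) (proj₁ (proj₂ (leafPosOf v))) (subst (_∈ _) (sym (proj₂ (proj₂ (leafPosOf v)))) v∈))

  ⊑posOf⇒∈subtree : ∀ c {v} → c ⊑ pos (encode (posOf v)) → v ∈ leaves (subtreeAt β c)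
  ⊑posOf⇒∈subtree c {v} c⊑ = subst (_∈ _) (proj₂ (proj₂ (leafPosOf v))) (⊑⇒∈subtreeAt (subst (c ⊑_) (decode-encode (posOf v)) c⊑))

  cut-is-subtree : ∀ t u → E T t u → ∀ A → IsCutOf t u A →
                   ∃ λ (c : P) → A ≡ leaves (subtreeAt β c) ⊎ A ≡ ∁ (leaves (subtreeAt β c))
  cut-is-subtree t u e A cut with E⇒Child t u e
  ... | inj₂ u→t = pos t , inj₁ (⊆-antisym
    (λ v∈A → ⊑posOf⇒∈subtree (pos t) (childSide⇒⊑ u→t (proj₁ (cut _) v∈A)))
    (λ v∈S → proj₂ (cut _) (⊑⇒childSide u→t (∈subtree⇒⊑posOf (pos t) v∈S))))
  ... | inj₁ t→u = pos u , inj₂ (⊆-antisym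
    (λ v∈A → x∉p⇒x∈∁p λ v∈S → parentSide⇒⋢ t→u (proj₁ (cut _) v∈A) (∈subtree⇒⊑posOf (pos u) v∈S))
    (λ v∈∁S → proj₂ (cut _) (⋢⇒parentSide t→u λ u⊑ → x∈∁p⇒x∉p v∈∁S (⊑posOf⇒∈subtree (pos u) u⊑))))

module _ {n : ℕ} (G : Graph n) where

  CrossCover : Subset n → Subset n → Set
  CrossCover A S = ∀ x y → x ∈ A → y ∉ A → E G x y → x ∈ S ⊎ y ∈ S

  CrossCover-∁ : ∀ {A S} → CrossCover A S → CrossCover (∁ A) S
  CrossCover-∁ cover x y x∈∁A y∉∁A e = swap (cover y x (x∉∁p⇒x∈p y∉∁A) (x∈∁p⇒x∉p x∈∁A) (E-sym G e))

  -- Each edge of a matching across the cut has an endpoint in the cover, and distinct edges give distinct endpoints.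
  CrossCover⇒mm≤ : ∀ {A S b} → CrossCover A S → ∣ S ∣ ≤ b → mm≤ G A b
  CrossCover⇒mm≤ {A} {S} cover ∣S∣≤b M (crossing , distinct₁ , distinct₂) =
    ≤-trans (≤-reflexive (sym (length-map pick M)))
            (≤-trans (length≤∣p∣ S (map pick M) (Unique-pick M crossing distinct₁ distinct₂) (pick∈S M crossing)) ∣S∣≤b)
    where
    Crossing : Fin n × Fin n → Set
    Crossing (x , y) = x ∈ A × y ∉ A × E G x y

    pick : Fin n × Fin n → Fin n
    pick (x , y) with x ∈? S
    ... | yes _ = x
    ... | no _ = y

    pick-∈ : ∀ p → Crossing p → pick p ∈ S
    pick-∈ (x , y) (x∈A , y∉A , e) with x ∈? S
    ... | yes x∈S = x∈S
    ... | no x∉S with cover x y x∈A y∉A e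
    ... | inj₁ x∈S = ⊥-elim (x∉S x∈S)
    ... | inj₂ y∈S = y∈S

    pick-≢ : ∀ p q → Crossing p → Crossing q → proj₁ p ≢ proj₁ q → proj₂ p ≢ proj₂ q → pick p ≢ pick q
    pick-≢ (x , y) (x' , y') (x∈A , y∉A , _) (x'∈A , y'∉A , _) x≢x' y≢y' with x ∈? S | x' ∈? S
    ... | yes _ | yes _ = x≢x'
    ... | no _ | no _ = y≢y'
    ... | yes _ | no _ = λ x≡y' → y'∉A (subst (_∈ A) x≡y' x∈A)
    ... | no _ | yes _ = λ y≡x' → y∉A (subst (_∈ A) (sym y≡x') x'∈A)

    pick∈S : ∀ M → All Crossing M → All (_∈ S) (map pick M)
    pick∈S [] _ = []
    pick∈S (p ∷ M) (c ∷ cs) = pick-∈ p c ∷ pick∈S M cs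

    Unique-pick : ∀ M → All Crossing M → Unique (map proj₁ M) → Unique (map proj₂ M) → Unique (map pick M)
    Unique-pick [] _ _ _ = []
    Unique-pick (p ∷ M) (c ∷ cs) (p₁∉ ∷ u₁) (p₂∉ ∷ u₂) = pick-∉ M cs p₁∉ p₂∉ ∷ Unique-pick M cs u₁ u₂
      where
      pick-∉ : ∀ M' → All Crossing M' → All (proj₁ p ≢_) (map proj₁ M') → All (proj₂ p ≢_) (map proj₂ M') →
               All (pick p ≢_) (map pick M')
      pick-∉ [] _ _ _ = []
      pick-∉ (q ∷ M') (c' ∷ cs') (≢₁ ∷ r₁) (≢₂ ∷ r₂) = pick-≢ p q c c' ≢₁ ≢₂ ∷ pick-∉ M' cs' r₁ r₂

tw+1≤⇒smw≤ : ∀ {n} (G : Graph (suc n)) b → tw+1≤ G b → smw≤ G b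
tw+1≤⇒smw≤ G b TD = branchDecomposition , sm≤b
  where
  open FromTreeDecomposition TD using (BoundaryInBag; binTree; home; ∈bag-home)
  open TreeDecomposition TD using (bag; bagSize)
  β : BinTree
  β = proj₁ (binTree zero)
  open ToBranchDecomposition G β (proj₁ (proj₂ (binTree zero))) (proj₂ (proj₂ (proj₂ (binTree zero))))

  1≤b : 1 ≤ b
  1≤b = ≤-trans (length≤∣p∣ (bag (home zero)) (zero ∷ []) ([] ∷ []) (∈bag-home zero ∷ [])) (bagSize (home zero))

  boundary-sm≤ : ∀ {A} → BoundaryInBag A → sm≤ G A b
  boundary-sm≤ (s , cover) = (λ _ → 1≤b) , (λ _ → CrossCover⇒mm≤ G cover (bagSize s))

  boundary-∁-sm≤ : ∀ {A} → BoundaryInBag A → sm≤ G (∁ A) b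
  boundary-∁-sm≤ (s , cover) = (λ _ → 1≤b) , (λ _ → CrossCover⇒mm≤ G (CrossCover-∁ G cover) (bagSize s))

  sm≤b : BranchDecomposition.smWidth≤ branchDecomposition b
  sm≤b t u e A cut with cut-is-subtree t u e A cut
  ... | c , inj₁ refl = boundary-sm≤ (AllSubtrees-at β (proj₁ (proj₂ (proj₂ (binTree zero)))) c)
  ... | c , inj₂ refl = boundary-∁-sm≤ (AllSubtrees-at β (proj₁ (proj₂ (proj₂ (binTree zero)))) c)

-- Neighbourhood classes of a cut

#classes : ℕ → ℕ
#classes k = 2 + (k + 2 ^ k)

module _ {n : ℕ} (G : Graph n) where

  Classifies : ∀ {c} → Subset n → (Fin n → Fin c) → Set
  Classifies A cls = ∀ x y → x ∈ A → y ∈ A → cls x ≡ cls y → ∀ z → z ∉ A → adj G x z ≡ adj G y z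

  Classifies-∘ : ∀ {c d A} {cls : Fin n → Fin c} (f : Fin c → Fin d) → (∀ {i j} → f i ≡ f j → i ≡ j) →
                 Classifies A cls → Classifies A (λ x → f (cls x))
  Classifies-∘ f f-injective classifies x y x∈A y∈A e = classifies x y x∈A y∈A (f-injective e)

  module _ (A : Subset n) where

    HasOutNeighbour : Fin n → Set
    HasOutNeighbour x = ∃ λ z → z ∉ A × E G x z

    HasOutNeighbour? : ∀ x → Dec (HasOutNeighbour x)
    HasOutNeighbour? x = any? (λ z → ¬? (z ∈? A) ×-dec E? G x z)

    SplitLike : Set
    SplitLike = ∀ x y → x ∈ A → y ∈ A → HasOutNeighbour x → HasOutNeighbour y → ∀ z → z ∉ A → adj G x z ≡ adj G y z

    SplitLike? : Dec SplitLike
    SplitLike? = all? λ x → all? λ y → (x ∈? A) →-dec ((y ∈? A) →-dec ((HasOutNeighbour? x) →-dec ((HasOutNeighbour? y) →-dec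
                   all? λ z → (¬? (z ∈? A)) →-dec (adj G x z Bool.≟ adj G y z))))

    SplitLike⇒classes : SplitLike → Σ (Fin n → Fin 2) (Classifies A)
    SplitLike⇒classes split = (λ x → toBit (HasOutNeighbour? x)) , classifies
      where
      toBit : ∀ {x} → Dec (HasOutNeighbour x) → Fin 2
      toBit (yes _) = suc zero
      toBit (no _) = zero
      no-out : ∀ {x} → ¬ HasOutNeighbour x → ∀ z → z ∉ A → adj G x z ≡ false
      no-out ¬out z z∉A = Bool.¬-not (λ e → ¬out (z , z∉A , e))
      classifies : Classifies A (λ x → toBit (HasOutNeighbour? x))
      classifies x y x∈A y∈A eq z z∉A = go (HasOutNeighbour? x) (HasOutNeighbour? y) eq
        where
        go : (dx : Dec (HasOutNeighbour x)) (dy : Dec (HasOutNeighbour y)) → toBit dx ≡ toBit dy → adj G x z ≡ adj G y z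
        go (yes out-x) (yes out-y) _ = split x y x∈A y∈A out-x out-y z z∉A
        go (no ¬out-x) (no ¬out-y) _ = trans (no-out ¬out-x z z∉A) (sym (no-out ¬out-y z z∉A))
        go (yes _) (no _) ()
        go (no _) (yes _) ()

    record MaximalCrossMatching : Set where
      field
        M : List (Fin n × Fin n)
        matching : IsCrossMatching G A M
        maximal : ∀ x → x ∈ A → ¬ (x ∈ₗ map proj₁ M) → ∀ z → z ∉ A → E G x z → z ∈ₗ map proj₂ M

    private
      Free : Fin n → List (Fin n × Fin n) → Fin n → Set
      Free x M z = z ∉ A × E G x z × ¬ (z ∈ₗ map proj₂ M)

      Free? : ∀ x M → Dec (∃ (Free x M))
      Free? x M = any? (λ z → ¬? (z ∈? A) ×-dec (E? G x z ×-dec ¬? (z ∈ₗ? map proj₂ M)))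

      extend : (x : Fin n) (M : List (Fin n × Fin n)) → Dec (x ∈ A) → Dec (∃ (Free x M)) → List (Fin n × Fin n)
      extend x M (yes _) (yes (z , _)) = (x , z) ∷ M
      extend x M (yes _) (no _) = M
      extend x M (no _) _ = M

      greedy : List (Fin n) → List (Fin n × Fin n)
      greedy [] = []
      greedy (x ∷ xs) = extend x (greedy xs) (x ∈? A) (Free? x (greedy xs))

      record Greedy (xs : List (Fin n)) (M : List (Fin n × Fin n)) : Set where
        field
          crossing : All (λ p → proj₁ p ∈ A × proj₂ p ∉ A × E G (proj₁ p) (proj₂ p)) M
          unique₂ : Unique (map proj₂ M)
          ⊆xs : ∀ x → x ∈ₗ map proj₁ M → x ∈ₗ xs
          unique₁ : Unique xs → Unique (map proj₁ M)
          maximal : ∀ x → x ∈ₗ xs → x ∈ A → ¬ (x ∈ₗ map proj₁ M) → ∀ z → z ∉ A → E G x z → z ∈ₗ map proj₂ M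

      greedy-ok : ∀ xs → Greedy xs (greedy xs)
      greedy-ok [] = record { crossing = [] ; unique₂ = [] ; ⊆xs = λ _ () ; unique₁ = λ _ → [] ; maximal = λ _ () }
      greedy-ok (x ∷ xs) = go (x ∈? A) (Free? x (greedy xs))
        where
        module I = Greedy (greedy-ok xs)
        go : (x∈A? : Dec (x ∈ A)) (free? : Dec (∃ (Free x (greedy xs)))) → Greedy (x ∷ xs) (extend x (greedy xs) x∈A? free?)
        go (yes x∈A) (yes (z , z∉A , e , z-free)) = record
          { crossing = (x∈A , z∉A , e) ∷ I.crossing
          ; unique₂ = ¬Any⇒All¬ _ z-free ∷ I.unique₂
          ; ⊆xs = λ { y (here refl) → here refl ; y (there y∈) → there (I.⊆xs y y∈) }
          ; unique₁ = λ { (x∉xs ∷ u) → ¬Any⇒All¬ _ (λ x∈ → Unique.Unique[x∷xs]⇒x∉xs (x∉xs ∷ u) (I.⊆xs x x∈)) ∷ I.unique₁ u }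
          ; maximal = λ { y (here refl) _ unmatched → ⊥-elim (unmatched (here refl))
                        ; y (there y∈) y∈A unmatched z' z'∉A e' → there (I.maximal y y∈ y∈A (λ j → unmatched (there j)) z' z'∉A e') } }
        go (yes x∈A) (no none-free) = record
          { crossing = I.crossing ; unique₂ = I.unique₂
          ; ⊆xs = λ y y∈ → there (I.⊆xs y y∈)
          ; unique₁ = λ { (_ ∷ u) → I.unique₁ u }
          ; maximal = λ { y (here refl) _ _ z z∉A e → matched z z∉A e
                        ; y (there y∈) y∈A unmatched → I.maximal y y∈ y∈A unmatched } }
          where
          matched : ∀ z → z ∉ A → E G x z → z ∈ₗ map proj₂ (greedy xs)
          matched z z∉A e with z ∈ₗ? map proj₂ (greedy xs)
          ... | yes z∈ = z∈
          ... | no z∉ = ⊥-elim (none-free (z , z∉A , e , z∉))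
        go (no x∉A) _ = record
          { crossing = I.crossing ; unique₂ = I.unique₂
          ; ⊆xs = λ y y∈ → there (I.⊆xs y y∈)
          ; unique₁ = λ { (_ ∷ u) → I.unique₁ u }
          ; maximal = λ { y (here refl) y∈A → ⊥-elim (x∉A y∈A)
                        ; y (there y∈) y∈A unmatched → I.maximal y y∈ y∈A unmatched } }

    maximalCrossMatching : MaximalCrossMatching
    maximalCrossMatching = record
      { M = greedy (allFin n)
      ; matching = G.crossing , G.unique₁ (Unique.allFin⁺ n) , G.unique₂
      ; maximal = λ x → G.maximal x (∈-allFin x) }
      where module G = Greedy (greedy-ok (allFin n))

    -- Matched vertices of A get a class of their own; an unmatched vertex of A has all its
    -- neighbours outside A among the matched ones, so it is classified by its adjacencies to those.
    mm≤⇒classes : ∀ {k} → mm≤ G A k → Σ (Fin n → Fin (k + 2 ^ k)) (Classifies A)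
    mm≤⇒classes {k} mm≤k = cls , classifies
      where
      open MaximalCrossMatching maximalCrossMatching
      M₁ M₂ : List (Fin n)
      M₁ = map proj₁ M
      M₂ = map proj₂ M
      ∣M₁∣≤k : length M₁ ≤ k
      ∣M₁∣≤k = ≤-trans (≤-reflexive (length-map proj₁ M)) (mm≤k M matching)
      2^∣M₂∣≤2^k : 2 ^ length M₂ ≤ 2 ^ k
      2^∣M₂∣≤2^k = ^-monoʳ-≤ 2 (≤-trans (≤-reflexive (length-map proj₂ M)) (mm≤k M matching))

      adjacencies : Fin n → Vec Bool (length M₂)
      adjacencies x = tabulate (λ j → adj G x (List.lookup M₂ j))

      clsOf : ∀ {x} → Dec (x ∈ₗ M₁) → Fin (k + 2 ^ k)
      clsOf (yes x∈) = inject≤ (index x∈) ∣M₁∣≤k ↑ˡ 2 ^ k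
      clsOf {x} (no _) = k ↑ʳ inject≤ (bits→Fin (adjacencies x)) 2^∣M₂∣≤2^k

      cls : Fin n → Fin (k + 2 ^ k)
      cls x = clsOf (x ∈ₗ? M₁)

      same-adjacencies : ∀ a b → a ∈ A → ¬ (a ∈ₗ M₁) → adjacencies a ≡ adjacencies b → ∀ z → z ∉ A →
                         adj G a z ≡ true → adj G b z ≡ true
      same-adjacencies a b a∈A a-unmatched eq z z∉A e = trans (sym (subst (λ w → adj G a w ≡ adj G b w) (sym (lookup-index z∈M₂)) at-z)) e
        where
        z∈M₂ : z ∈ₗ M₂
        z∈M₂ = maximal a a∈A a-unmatched z z∉A e
        at-z : adj G a (List.lookup M₂ (index z∈M₂)) ≡ adj G b (List.lookup M₂ (index z∈M₂))
        at-z = trans (sym (lookup∘tabulate _ (index z∈M₂))) (trans (cong (λ v → lookup v (index z∈M₂)) eq) (lookup∘tabulate _ (index z∈M₂)))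

      classifies : Classifies A cls
      classifies x y x∈A y∈A eq z z∉A = go (x ∈ₗ? M₁) (y ∈ₗ? M₁) eq
        where
        go : (dx : Dec (x ∈ₗ M₁)) (dy : Dec (y ∈ₗ M₁)) → clsOf dx ≡ clsOf dy → adj G x z ≡ adj G y z
        go (yes x∈) (yes y∈) e = cong (λ w → adj G w z)
          (trans (lookup-index x∈) (trans (cong (List.lookup M₁) (inject≤-injective ∣M₁∣≤k ∣M₁∣≤k _ _ (↑ˡ-injective (2 ^ k) _ _ e))) (sym (lookup-index y∈))))
        go (no x∉) (no y∉) e = Bool-ext (same-adjacencies x y x∈A x∉ same z z∉A) (same-adjacencies y x y∈A y∉ (sym same) z z∉A)
          where
          same : adjacencies x ≡ adjacencies y
          same = bits→Fin-injective _ _ (inject≤-injective 2^∣M₂∣≤2^k 2^∣M₂∣≤2^k _ _ (↑ʳ-injective k _ _ e))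
        go (yes _) (no _) e = ⊥-elim (↑ˡ≢↑ʳ _ _ e)
        go (no _) (yes _) e = ⊥-elim (↑ˡ≢↑ʳ _ _ (sym e))

    sm≤⇒classes : ∀ {k} → sm≤ G A k → Σ (Fin n → Fin (#classes k)) (Classifies A)
    sm≤⇒classes {k} sm≤k with SplitLike?
    ... | yes split = _ , Classifies-∘ (_↑ˡ (k + 2 ^ k)) (↑ˡ-injective (k + 2 ^ k) _ _) (proj₂ (SplitLike⇒classes split))
    ... | no ¬split = _ , Classifies-∘ (2 ↑ʳ_) (↑ʳ-injective 2 _ _) (proj₂ (mm≤⇒classes (proj₂ sm≤k (λ s → ¬split (proj₂ (proj₂ s))))))

-- Clique-width expressions

module _ {K : ℕ} where

  label-relab-hit : ∀ {a} (e : Expr K a) i j x → label e x ≡ i → label (relab i j e) x ≡ j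
  label-relab-hit e i j x eq with label e x ≟ i
  ... | yes _ = refl
  ... | no ne = ⊥-elim (ne eq)

  label-relab-miss : ∀ {a} (e : Expr K a) i j x → label e x ≢ i → label (relab i j e) x ≡ label e x
  label-relab-miss e i j x ne with label e x ≟ i
  ... | yes eq = ⊥-elim (ne eq)
  ... | no _ = refl

∨-true⁻ : ∀ {a b} → a ∨ b ≡ true → a ≡ true ⊎ b ≡ true
∨-true⁻ {true} _ = inj₁ refl
∨-true⁻ {false} e = inj₂ e

∧-true⁻ : ∀ {a b} → a ∧ b ≡ true → a ≡ true × b ≡ true
∧-true⁻ {a} {b} e = Bool.∧-conicalˡ a b e , Bool.∧-conicalʳ a b e

⌊⌋-true⁻ : ∀ {A : Set} (d : Dec A) → ⌊ d ⌋ ≡ true → A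
⌊⌋-true⁻ (yes a) _ = a

⌊⌋-true : ∀ {A : Set} (d : Dec A) → A → ⌊ d ⌋ ≡ true
⌊⌋-true (yes _) _ = refl
⌊⌋-true (no ¬a) a = ⊥-elim (¬a a)

module CliqueExpression {n : ℕ} (G : Graph n) (k : ℕ) where

  L : ℕ
  L = #classes k

  -- Labels come in three ranges of L classes each: 0 and 1 for the two parts of a node being
  -- joined, 2 for a finished subexpression.
  K : ℕ
  K = 3 * L

  lab : Fin 3 → Fin L → Fin K
  lab = combine

  lab₀ lab₁ lab₂ : Fin L → Fin K
  lab₀ = lab zero
  lab₁ = lab (suc zero)
  lab₂ = lab (suc (suc zero))

  lab-injective : ∀ s i j → lab s i ≡ lab s j → i ≡ j
  lab-injective s i j = combine-injectiveʳ s i s j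

  lab-≢ : ∀ s t {i j} → s ≢ t → lab s i ≢ lab t j
  lab-≢ s t {i} {j} s≢t e = s≢t (combine-injectiveˡ s i t j e)

  relabelAll : ∀ {a} (f : Fin L → Fin K) (s : Fin 3) → List (Fin L) → Expr K a → Expr K a
  relabelAll f s [] e = e
  relabelAll f s (i ∷ is) e = relabelAll f s is (relab (lab s i) (f i) e)

  eadj-relabelAll : ∀ {a} f s is (e : Expr K a) x y → eadj (relabelAll f s is e) x y ≡ eadj e x y
  eadj-relabelAll f s [] e x y = refl
  eadj-relabelAll f s (i ∷ is) e x y = eadj-relabelAll f s is (relab (lab s i) (f i) e) x y

  module _ (f : Fin L → Fin K) (s : Fin 3) (f∉range : ∀ i j → f i ≢ lab s j) where

    label-relabelAll-miss : ∀ {a} is (e : Expr K a) x → (∀ q → label e x ≢ lab s q) → label (relabelAll f s is e) x ≡ label e x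
    label-relabelAll-miss [] e x miss = refl
    label-relabelAll-miss (i ∷ is) e x miss =
      trans (label-relabelAll-miss is (relab (lab s i) (f i) e) x
               (λ q eq → miss q (trans (sym (label-relab-miss e (lab s i) (f i) x (miss i))) eq)))
            (label-relab-miss e (lab s i) (f i) x (miss i))

    label-relabelAll-hit : ∀ {a} is (e : Expr K a) x q → label e x ≡ lab s q → q ∈ₗ is → label (relabelAll f s is e) x ≡ f q
    label-relabelAll-hit (i ∷ is) e x q eq q∈ with q ≟ i
    ... | yes refl = trans (label-relabelAll-miss is (relab (lab s q) (f q) e) x (λ q' e' → f∉range q q' (trans (sym hit) e'))) hit
      where
      hit : label (relab (lab s q) (f q) e) x ≡ f q
      hit = label-relab-hit e (lab s q) (f q) x eq
    ... | no q≢i with q∈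
    ... | here q≡i = ⊥-elim (q≢i q≡i)
    ... | there q∈is = label-relabelAll-hit is (relab (lab s i) (f i) e) x q
                         (trans (label-relab-miss e (lab s i) (f i) x (λ e₂ → q≢i (lab-injective s q i (trans (sym eq) e₂)))) eq) q∈is

  lab₀≢lab₁ : ∀ a b → lab₀ a ≢ lab₁ b
  lab₀≢lab₁ a b = lab-≢ zero (suc zero) (λ ())

  allClasses : List (Fin L)
  allClasses = allFin L

  allPairs : List (Fin L × Fin L)
  allPairs = cartesianProduct allClasses allClasses

  ∈allPairs : ∀ a b → (a , b) ∈ₗ allPairs
  ∈allPairs a b = ∈-cartesianProductWith⁺ _,_ (∈-allFin a) (∈-allFin b)

  module Joins (A₁ A₂ : Subset n) (cls₁ cls₂ : Fin n → Fin L) where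

    Adjacent : Fin L → Fin L → Set
    Adjacent a b = ∃ λ x → ∃ λ y → x ∈ A₁ × y ∈ A₂ × cls₁ x ≡ a × cls₂ y ≡ b × E G x y

    Adjacent? : ∀ a b → Dec (Adjacent a b)
    Adjacent? a b = any? λ x → any? λ y → (x ∈? A₁) ×-dec ((y ∈? A₂) ×-dec ((cls₁ x ≟ a) ×-dec ((cls₂ y ≟ b) ×-dec E? G x y)))

    joinIf : ∀ {s} (a b : Fin L) → Dec (Adjacent a b) → Expr K s → Expr K s
    joinIf a b (yes _) e = join (lab₀ a) (lab₁ b) (lab₀≢lab₁ a b) e
    joinIf a b (no _) e = e

    joinAll : ∀ {s} → List (Fin L × Fin L) → Expr K s → Expr K s
    joinAll [] e = e
    joinAll ((a , b) ∷ ps) e = joinIf a b (Adjacent? a b) (joinAll ps e)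

    joined : (a b : Fin L) → Dec (Adjacent a b) → Fin K → Fin K → Bool
    joined a b (yes _) l₁ l₂ = (⌊ l₁ ≟ lab₀ a ⌋ ∧ ⌊ l₂ ≟ lab₁ b ⌋) ∨ (⌊ l₁ ≟ lab₁ b ⌋ ∧ ⌊ l₂ ≟ lab₀ a ⌋)
    joined a b (no _) l₁ l₂ = false

    anyJoined : List (Fin L × Fin L) → Fin K → Fin K → Bool
    anyJoined [] l₁ l₂ = false
    anyJoined ((a , b) ∷ ps) l₁ l₂ = joined a b (Adjacent? a b) l₁ l₂ ∨ anyJoined ps l₁ l₂

    label-joinAll : ∀ {s} ps (e : Expr K s) x → label (joinAll ps e) x ≡ label e x
    label-joinAll [] e x = refl
    label-joinAll ((a , b) ∷ ps) e x with Adjacent? a b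
    ... | yes _ = label-joinAll ps e x
    ... | no _ = label-joinAll ps e x

    eadj-joinIf : ∀ {s} a b d (e : Expr K s) x y → eadj (joinIf a b d e) x y ≡ eadj e x y ∨ joined a b d (label e x) (label e y)
    eadj-joinIf a b (yes _) e x y = refl
    eadj-joinIf a b (no _) e x y = sym (Bool.∨-identityʳ _)

    eadj-joinAll : ∀ {s} ps (e : Expr K s) x y → eadj (joinAll ps e) x y ≡ eadj e x y ∨ anyJoined ps (label e x) (label e y)
    eadj-joinAll [] e x y = sym (Bool.∨-identityʳ _)
    eadj-joinAll ((a , b) ∷ ps) e x y =
      begin
        eadj (joinIf a b d (joinAll ps e)) x y
      ≡⟨ eadj-joinIf a b d (joinAll ps e) x y ⟩
        eadj (joinAll ps e) x y ∨ joined a b d (label (joinAll ps e) x) (label (joinAll ps e) y)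
      ≡⟨ cong₂ _∨_ (eadj-joinAll ps e x y) (cong₂ (joined a b d) (label-joinAll ps e x) (label-joinAll ps e y)) ⟩
        (eadj e x y ∨ anyJoined ps (label e x) (label e y)) ∨ joined a b d (label e x) (label e y)
      ≡⟨ Bool.∨-assoc (eadj e x y) _ _ ⟩
        eadj e x y ∨ (anyJoined ps (label e x) (label e y) ∨ joined a b d (label e x) (label e y))
      ≡⟨ cong (eadj e x y ∨_) (Bool.∨-comm (anyJoined ps (label e x) (label e y)) _) ⟩
        eadj e x y ∨ anyJoined ((a , b) ∷ ps) (label e x) (label e y)
      ∎
      where
      open ≡-Reasoning
      d : Dec (Adjacent a b)
      d = Adjacent? a b

    joined-sym : ∀ a b d l₁ l₂ → joined a b d l₁ l₂ ≡ joined a b d l₂ l₁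
    joined-sym a b (yes _) l₁ l₂ =
      trans (Bool.∨-comm (⌊ l₁ ≟ lab₀ a ⌋ ∧ ⌊ l₂ ≟ lab₁ b ⌋) _)
            (cong₂ _∨_ (Bool.∧-comm ⌊ l₁ ≟ lab₁ b ⌋ _) (Bool.∧-comm ⌊ l₁ ≟ lab₀ a ⌋ _))
    joined-sym a b (no _) l₁ l₂ = refl

    anyJoined-sym : ∀ ps l₁ l₂ → anyJoined ps l₁ l₂ ≡ anyJoined ps l₂ l₁
    anyJoined-sym [] l₁ l₂ = refl
    anyJoined-sym ((a , b) ∷ ps) l₁ l₂ = cong₂ _∨_ (joined-sym a b (Adjacent? a b) l₁ l₂) (anyJoined-sym ps l₁ l₂)

    NotCrossLabels : Fin K → Fin K → Set
    NotCrossLabels l₁ l₂ = ∀ a b → ¬ (l₁ ≡ lab₀ a × l₂ ≡ lab₁ b) × ¬ (l₁ ≡ lab₁ b × l₂ ≡ lab₀ a)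

    anyJoined-false : ∀ ps {l₁ l₂} → NotCrossLabels l₁ l₂ → anyJoined ps l₁ l₂ ≡ false
    anyJoined-false [] _ = refl
    anyJoined-false ((a , b) ∷ ps) {l₁} {l₂} not-cross =
      cong₂ _∨_ (joined-false (Adjacent? a b)) (anyJoined-false ps not-cross)
      where
      joined-false : ∀ d → joined a b d l₁ l₂ ≡ false
      joined-false (no _) = refl
      joined-false (yes _) = Bool.¬-not λ t → case (∨-true⁻ t)
        where
        case : _ → ⊥
        case (inj₁ t₁) = proj₁ (not-cross a b) (⌊⌋-true⁻ (l₁ ≟ _) (proj₁ (∧-true⁻ t₁)) , ⌊⌋-true⁻ (l₂ ≟ _) (proj₂ (∧-true⁻ t₁)))
        case (inj₂ t₂) = proj₂ (not-cross a b) (⌊⌋-true⁻ (l₁ ≟ _) (proj₁ (∧-true⁻ t₂)) , ⌊⌋-true⁻ (l₂ ≟ _) (proj₂ (∧-true⁻ t₂)))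

    anyJoined⇒Adjacent : ∀ ps a' b' → anyJoined ps (lab₀ a') (lab₁ b') ≡ true → Adjacent a' b'
    anyJoined⇒Adjacent ((a , b) ∷ ps) a' b' t with ∨-true⁻ {joined a b (Adjacent? a b) (lab₀ a') (lab₁ b')} t
    ... | inj₂ t' = anyJoined⇒Adjacent ps a' b' t'
    ... | inj₁ t₁ = go (Adjacent? a b) t₁
      where
      go : (d : Dec (Adjacent a b)) → joined a b d (lab₀ a') (lab₁ b') ≡ true → Adjacent a' b'
      go (yes adj-ab) t with ∨-true⁻ t
      ... | inj₁ u with lab-injective zero a' a (⌊⌋-true⁻ (lab₀ a' ≟ lab₀ a) (proj₁ (∧-true⁻ u)))
                      | lab-injective (suc zero) b' b (⌊⌋-true⁻ (lab₁ b' ≟ lab₁ b) (proj₂ (∧-true⁻ u)))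
      ... | refl | refl = adj-ab
      go (yes _) t | inj₂ u = ⊥-elim (lab₀≢lab₁ a' b (⌊⌋-true⁻ (lab₀ a' ≟ lab₁ b) (proj₁ (∧-true⁻ u))))

    Adjacent⇒anyJoined : ∀ ps a' b' → Adjacent a' b' → (a' , b') ∈ₗ ps → anyJoined ps (lab₀ a') (lab₁ b') ≡ true
    Adjacent⇒anyJoined ((a , b) ∷ ps) a' b' adj (there ab∈) rewrite Adjacent⇒anyJoined ps a' b' adj ab∈ = Bool.∨-zeroʳ _
    Adjacent⇒anyJoined ((a , b) ∷ ps) a b adj (here refl) with Adjacent? a b
    ... | no ¬adj = ⊥-elim (¬adj adj)
    ... | yes _ rewrite ⌊⌋-true (lab₀ a ≟ lab₀ a) refl | ⌊⌋-true (lab₁ b ≟ lab₁ b) refl = refl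

  record Expression (β : BinTree {n}) : Set where
    field
      expr : Expr K (size β)
      cls : Fin n → Fin L
      classifies : Classifies G (leaves β) cls
      label≡ : ∀ i → label expr i ≡ lab₂ (cls (leafAt β i))
      eadj≡ : ∀ i j → eadj expr i j ≡ adj G (leafAt β i) (leafAt β j)

  leafExpression : ∀ v → Expression (leaf v)
  leafExpression v = record
    { expr = vtx (lab₂ zero) ; cls = λ _ → zero
    ; classifies = λ x y x∈ y∈ _ z _ → cong (λ w → adj G w z) (trans (x∈⁅y⁆⇒x≡y v x∈) (sym (x∈⁅y⁆⇒x≡y v y∈)))
    ; label≡ = λ _ → refl ; eadj≡ = λ _ _ → sym (irrefl G v) }

  module Node (l r : BinTree) (disj : ∀ x → x ∈ leaves l → x ∉ leaves r) (El : Expression l) (Er : Expression r) where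

    A₁ A₂ A : Subset n
    A₁ = leaves l
    A₂ = leaves r
    A = A₁ ∪ A₂
    open Expression El renaming (expr to e₁; cls to cls₁; classifies to classifies₁; label≡ to label≡₁; eadj≡ to eadj≡₁)
    open Expression Er renaming (expr to e₂; cls to cls₂; classifies to classifies₂; label≡ to label≡₂; eadj≡ to eadj≡₂)
    open Joins A₁ A₂ cls₁ cls₂

    e₁′ : Expr K (size l)
    e₁′ = relabelAll lab₀ (suc (suc zero)) allClasses e₁
    e₂′ : Expr K (size r)
    e₂′ = relabelAll lab₁ (suc (suc zero)) allClasses e₂
    joinedExpr : Expr K (size (node l r))
    joinedExpr = joinAll allPairs (e₁′ ⊕ e₂′)

    label-e₁′ : ∀ i → label e₁′ i ≡ lab₀ (cls₁ (leafAt l i))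
    label-e₁′ i = label-relabelAll-hit lab₀ (suc (suc zero)) (λ _ _ → lab-≢ zero (suc (suc zero)) (λ ())) allClasses e₁ i _ (label≡₁ i) (∈-allFin _)

    label-e₂′ : ∀ i → label e₂′ i ≡ lab₁ (cls₂ (leafAt r i))
    label-e₂′ i = label-relabelAll-hit lab₁ (suc (suc zero)) (λ _ _ → lab-≢ (suc zero) (suc (suc zero)) (λ ())) allClasses e₂ i _ (label≡₂ i) (∈-allFin _)

    -- Adjacency between the two parts depends only on the classes, since each part classifies its
    -- vertices by their neighbourhoods outside it.
    Adjacent⇒E : ∀ x y → x ∈ A₁ → y ∈ A₂ → Adjacent (cls₁ x) (cls₂ y) → adj G x y ≡ true
    Adjacent⇒E x y x∈ y∈ (x₀ , y₀ , x₀∈ , y₀∈ , ex , ey , e₀) =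
      trans (Graph.sym G x y) (trans (sym (classifies₂ y₀ y y₀∈ y∈ ey x (disj x x∈)))
        (trans (Graph.sym G y₀ x) (trans (sym (classifies₁ x₀ x x₀∈ x∈ ex y₀ (λ h → disj y₀ h y₀∈))) e₀)))

    eadj-cross : ∀ a b → anyJoined allPairs (lab₀ (cls₁ (leafAt l a))) (lab₁ (cls₂ (leafAt r b))) ≡ adj G (leafAt l a) (leafAt r b)
    eadj-cross a b = Bool-ext
      (λ t → Adjacent⇒E _ _ (leafAt∈leaves l a) (leafAt∈leaves r b) (anyJoined⇒Adjacent allPairs _ _ t))
      (λ t → Adjacent⇒anyJoined allPairs _ _ (leafAt l a , leafAt r b , leafAt∈leaves l a , leafAt∈leaves r b , refl , refl , t) (∈allPairs _ _))

    eadj-joinedExpr : ∀ i j → eadj joinedExpr i j ≡ adj G (leafAt (node l r) i) (leafAt (node l r) j)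
    eadj-joinedExpr i j = trans (eadj-joinAll allPairs (e₁′ ⊕ e₂′) i j) go
      where
      go : eadj (e₁′ ⊕ e₂′) i j ∨ anyJoined allPairs (label (e₁′ ⊕ e₂′) i) (label (e₁′ ⊕ e₂′) j) ≡ adj G (leafAt (node l r) i) (leafAt (node l r) j)
      go with splitAt (size l) i | splitAt (size l) j
      ... | inj₁ a | inj₁ b rewrite label-e₁′ a | label-e₁′ b
            | anyJoined-false allPairs {lab₀ (cls₁ (leafAt l a))} {lab₀ (cls₁ (leafAt l b))}
                (λ _ _ → (λ h → lab₀≢lab₁ _ _ (proj₂ h)) , (λ h → lab₀≢lab₁ _ _ (proj₁ h)))
            = trans (Bool.∨-identityʳ _) (trans (eadj-relabelAll lab₀ (suc (suc zero)) allClasses e₁ a b) (eadj≡₁ a b))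
      ... | inj₂ a | inj₂ b rewrite label-e₂′ a | label-e₂′ b
            | anyJoined-false allPairs {lab₁ (cls₂ (leafAt r a))} {lab₁ (cls₂ (leafAt r b))}
                (λ _ _ → (λ h → lab₀≢lab₁ _ _ (sym (proj₁ h))) , (λ h → lab₀≢lab₁ _ _ (sym (proj₂ h))))
            = trans (Bool.∨-identityʳ _) (trans (eadj-relabelAll lab₁ (suc (suc zero)) allClasses e₂ a b) (eadj≡₂ a b))
      ... | inj₁ a | inj₂ b rewrite label-e₁′ a | label-e₂′ b = eadj-cross a b
      ... | inj₂ a | inj₁ b rewrite label-e₂′ a | label-e₁′ b =
            trans (anyJoined-sym allPairs _ _) (trans (eadj-cross b a) (Graph.sym G (leafAt l b) (leafAt r a)))

    label-joinedExpr : ∀ i → label joinedExpr i ≡ [ (λ a → lab₀ (cls₁ (leafAt l a))) , (λ b → lab₁ (cls₂ (leafAt r b))) ]′ (splitAt (size l) i)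
    label-joinedExpr i with label-joinAll allPairs (e₁′ ⊕ e₂′) i
    ... | eq with splitAt (size l) i
    ... | inj₁ a = trans eq (label-e₁′ a)
    ... | inj₂ b = trans eq (label-e₂′ b)

    -- The new class of a vertex must be a function of its old class, so each old class is
    -- represented by one of its members, whose class in A is taken.
    module Relabelled (sm≤k : sm≤ G A k) where

      clsA : Fin n → Fin L
      clsA = proj₁ (sm≤⇒classes G A sm≤k)

      classifiesA : Classifies G A clsA
      classifiesA = proj₂ (sm≤⇒classes G A sm≤k)

      module Representative (B : Subset n) (clsB : Fin n → Fin L) (B⊆A : ∀ {x} → x ∈ B → x ∈ A)
                            (classifiesB : Classifies G B clsB) where

        rep? : ∀ a → Dec (∃ λ x → x ∈ B × clsB x ≡ a)
        rep? a = any? (λ x → (x ∈? B) ×-dec (clsB x ≟ a))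

        newCls : Fin L → Fin L
        newCls a with rep? a
        ... | yes (x , _) = clsA x
        ... | no _ = zero

        newCls-spec : ∀ x → x ∈ B → ∃ λ x₀ → x₀ ∈ A × newCls (clsB x) ≡ clsA x₀ × (∀ z → z ∉ A → adj G x z ≡ adj G x₀ z)
        newCls-spec x x∈B with rep? (clsB x)
        ... | yes (x₀ , x₀∈B , e) = x₀ , B⊆A x₀∈B , refl , λ z z∉A → classifiesB x x₀ x∈B x₀∈B (sym e) z (λ z∈B → z∉A (B⊆A z∈B))
        ... | no ¬rep = ⊥-elim (¬rep (x , x∈B , refl))

      module R₁ = Representative A₁ cls₁ (λ x∈ → x∈p∪q⁺ (inj₁ x∈)) classifies₁
      module R₂ = Representative A₂ cls₂ (λ x∈ → x∈p∪q⁺ (inj₂ x∈)) classifies₂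

      expr : Expr K (size (node l r))
      expr = relabelAll (λ a → lab₂ (R₁.newCls a)) zero allClasses (relabelAll (λ b → lab₂ (R₂.newCls b)) (suc zero) allClasses joinedExpr)

      cls : Fin n → Fin L
      cls x with x ∈? A₁
      ... | yes _ = R₁.newCls (cls₁ x)
      ... | no _ = R₂.newCls (cls₂ x)

      cls-A₁ : ∀ {x} → x ∈ A₁ → cls x ≡ R₁.newCls (cls₁ x)
      cls-A₁ {x} x∈ with x ∈? A₁
      ... | yes _ = refl
      ... | no x∉ = ⊥-elim (x∉ x∈)

      cls-A₂ : ∀ {x} → x ∈ A₂ → cls x ≡ R₂.newCls (cls₂ x)
      cls-A₂ {x} x∈ with x ∈? A₁
      ... | yes x∈₁ = ⊥-elim (disj x x∈₁ x∈)
      ... | no _ = refl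

      cls-spec : ∀ x → x ∈ A → ∃ λ x₀ → x₀ ∈ A × cls x ≡ clsA x₀ × (∀ z → z ∉ A → adj G x z ≡ adj G x₀ z)
      cls-spec x x∈ with x∈p∪q⁻ A₁ A₂ x∈
      ... | inj₁ x∈₁ with R₁.newCls-spec x x∈₁
      ... | x₀ , x₀∈ , e , same = x₀ , x₀∈ , trans (cls-A₁ x∈₁) e , same
      cls-spec x x∈ | inj₂ x∈₂ with R₂.newCls-spec x x∈₂
      ... | x₀ , x₀∈ , e , same = x₀ , x₀∈ , trans (cls-A₂ x∈₂) e , same

      classifies : Classifies G A cls
      classifies x y x∈ y∈ eq z z∉A with cls-spec x x∈ | cls-spec y y∈
      ... | x₀ , x₀∈ , ex , same-x | y₀ , y₀∈ , ey , same-y =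
        trans (same-x z z∉A) (trans (classifiesA x₀ y₀ x₀∈ y₀∈ (trans (sym ex) (trans eq ey)) z z∉A) (sym (same-y z z∉A)))

      label≡ : ∀ i → label expr i ≡ lab₂ (cls (leafAt (node l r) i))
      label≡ i with splitAt (size l) i | label-joinedExpr i
      ... | inj₁ a | eq =
        trans (label-relabelAll-hit (λ a → lab₂ (R₁.newCls a)) zero (λ _ _ → lab-≢ (suc (suc zero)) zero (λ ())) allClasses _ i _
                 (trans (label-relabelAll-miss (λ b → lab₂ (R₂.newCls b)) (suc zero) (λ _ _ → lab-≢ (suc (suc zero)) (suc zero) (λ ())) allClasses joinedExpr i
                          (λ q e' → lab₀≢lab₁ _ q (trans (sym eq) e')))
                        eq)
                 (∈-allFin _))
              (cong lab₂ (sym (cls-A₁ (leafAt∈leaves l a))))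
      ... | inj₂ b | eq =
        trans (label-relabelAll-miss (λ a → lab₂ (R₁.newCls a)) zero (λ _ _ → lab-≢ (suc (suc zero)) zero (λ ())) allClasses _ i
                 (λ q e' → lab-≢ (suc (suc zero)) zero (λ ()) (trans (sym in-range₂) e')))
              (trans in-range₂ (cong lab₂ (sym (cls-A₂ (leafAt∈leaves r b)))))
        where
        in-range₂ : label (relabelAll (λ b → lab₂ (R₂.newCls b)) (suc zero) allClasses joinedExpr) i ≡ lab₂ (R₂.newCls (cls₂ (leafAt r b)))
        in-range₂ = label-relabelAll-hit (λ b → lab₂ (R₂.newCls b)) (suc zero) (λ _ _ → lab-≢ (suc (suc zero)) (suc zero) (λ ())) allClasses joinedExpr i _ eq (∈-allFin _)

      eadj≡ : ∀ i j → eadj expr i j ≡ adj G (leafAt (node l r) i) (leafAt (node l r) j)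
      eadj≡ i j = trans (eadj-relabelAll _ zero allClasses _ i j) (trans (eadj-relabelAll _ (suc zero) allClasses joinedExpr i j) (eadj-joinedExpr i j))

      expression : Expression (node l r)
      expression = record { expr = expr ; cls = cls ; classifies = classifies ; label≡ = label≡ ; eadj≡ = eadj≡ }

  expression : ∀ β → DistinctLeaves β → AllSubtrees (λ A → sm≤ G A k) β → Expression β
  expression (leaf v) _ _ = leafExpression v
  expression (node l r) (dl , dr , disj) (sm≤k , sml , smr) =
    Node.Relabelled.expression l r disj (expression l dl sml) (expression r dr smr) sm≤k

  -- At the root no relabelling is needed, so no width bound on the whole vertex set is required.
  rootExpression : ∀ l r → DistinctLeaves (node l r) → AllSubtrees (λ A → sm≤ G A k) l → AllSubtrees (λ A → sm≤ G A k) r →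
                   Σ (Expr K (size (node l r))) λ e → ∀ i j → eadj e i j ≡ adj G (leafAt (node l r) i) (leafAt (node l r) j)
  rootExpression l r (dl , dr , disj) sml smr = N.joinedExpr , N.eadj-joinedExpr
    where module N = Node l r disj (expression l dl sml) (expression r dr smr)

  cw≤-from : ∀ {a} (e : Expr K a) (φ : Fin a ↔ Fin n) →
             (∀ i j → eadj e i j ≡ adj G (Inverse.to φ i) (Inverse.to φ j)) → cw≤ G K
  cw≤-from e φ eadj≡ with ↔⇒≡ φ
  ... | refl = e , mk↔ₛ′ from to strictlyInverseʳ strictlyInverseˡ ,
               λ x y → trans (eadj≡ (from x) (from y)) (cong₂ (adj G) (strictlyInverseˡ x) (strictlyInverseˡ y))
    where open Inverse φ

-- From branch decompositions to clique-width expressions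

module FromBranchDecomposition {n : ℕ} {G : Graph n} {k : ℕ} (BD : BranchDecomposition G)
                               (sm≤k : BranchDecomposition.smWidth≤ BD k) where

  open BranchDecomposition BD using (m; T; isTree; maxDeg3; δ; leafOf; IsCutOf)
  open RootedTree T (proj₂ isTree)
  open CliqueExpression G k using (K; rootExpression; cw≤-from)

  vertexOf : ∀ t → IsLeaf T t → Fin n
  vertexOf t leaf-t = Inverse.to δ (t , leaf-t)

  leafOf-vertexOf : ∀ t (leaf-t : IsLeaf T t) → leafOf (vertexOf t leaf-t) ≡ t
  leafOf-vertexOf t leaf-t = cong proj₁ (Inverse.strictlyInverseʳ δ (t , leaf-t))

  leafOf≡⇒≡vertexOf : ∀ v t (leaf-t : IsLeaf T t) → leafOf v ≡ t → v ≡ vertexOf t leaf-t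
  leafOf≡⇒≡vertexOf v t leaf-t refl =
    trans (sym (Inverse.strictlyInverseˡ δ v)) (cong (λ l → Inverse.to δ (t , l)) (≤-irrelevant _ _))

  SideTree : Fin m → Fin m → Set
  SideTree t p = Σ BinTree λ β → DistinctLeaves β × AllSubtrees (λ A → sm≤ G A k) β × IsCutOf t p (leaves β)

  BranchTree : Fin m → List (Fin m) → Set
  BranchTree t [] = Unit
  BranchTree t (p ∷ _) = SideTree t p

  module Step (t p : Fin m) (ps : List (Fin m)) (rp : RootPath t (p ∷ ps))
              (rec : ∀ w → E T t w → w ≢ p → SideTree w t) where

    t~p : E T t p
    t~p with proj₁ rp
    ... | e ∷ _ = e

    IsChild : Fin m → Set
    IsChild w = E T t w × w ≢ p

    IsChild? : ∀ w → Dec (IsChild w)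
    IsChild? w = E? T t w ×-dec ¬? (w ≟ p)

    childList : List (Fin m)
    childList = filter IsChild? (allFin m)

    childList-unique : Unique childList
    childList-unique = Unique.filter⁺ IsChild? (Unique.allFin⁺ m)

    ∈childList⁺ : ∀ {w} → IsChild w → w ∈ₗ childList
    ∈childList⁺ {w} ch = ∈-filter⁺ IsChild? (∈-allFin w) ch

    ∈childList⁻ : ∀ {w} → w ∈ₗ childList → IsChild w
    ∈childList⁻ w∈ = proj₂ (∈-filter⁻ IsChild? {xs = allFin m} w∈)

    #children≤2 : 1 + length childList ≤ 3
    #children≤2 = ≤-trans (length≤degree T t (p ∷ childList) (p∉ ∷ childList-unique) (t~p ∷ all-adjacent childList (λ w∈ → w∈)))
                          (maxDeg3 t)
      where
      p∉ : All (p ≢_) childList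
      p∉ = ¬Any⇒All¬ _ (λ p∈ → proj₂ (∈childList⁻ p∈) refl)
      all-adjacent : ∀ ws → (∀ {w} → w ∈ₗ ws → w ∈ₗ childList) → All (E T t) ws
      all-adjacent [] _ = []
      all-adjacent (w ∷ ws) ⊆ = proj₁ (∈childList⁻ (⊆ (here refl))) ∷ all-adjacent ws (λ w∈ → ⊆ (there w∈))

    sm≤-side : ∀ β → IsCutOf t p (leaves β) → sm≤ G (leaves β) k
    sm≤-side β cut = sm≤k t p t~p (leaves β) cut

    leafCase : IsLeaf T t → SideTree t p
    leafCase leaf-t = leaf vt , tt , sm≤-side (leaf vt) cut , cut
      where
      vt : Fin n
      vt = vertexOf t leaf-t
      only-t : ∀ {x} → Reach (TminusEdge T t p) t x → x ≡ t
      only-t t↝x with Reach⇒InSubtree {t} {p ∷ ps} t↝x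
      ... | inj₁ x≡t = x≡t
      ... | inj₂ (w , e , w≢p , _) with ≤-trans (2≤degree T t t~p e (λ p≡w → w≢p (sym p≡w))) leaf-t
      ... | s≤s ()
      cut : IsCutOf t p ⁅ vt ⁆
      cut v = (λ v∈ → subst (λ y → Reach (TminusEdge T t p) t (leafOf y)) (sym (x∈⁅y⁆⇒x≡y vt v∈))
                        (subst (Reach (TminusEdge T t p) t) (sym (leafOf-vertexOf t leaf-t)) here))
            , (λ t↝v → subst (_∈ ⁅ vt ⁆) (sym (leafOf≡⇒≡vertexOf v t leaf-t (only-t t↝v))) (x∈⁅x⁆ vt))

    module Inner (inner : ¬ IsLeaf T t) where

      toBranch : ∀ v → Reach (TminusEdge T t p) t (leafOf v) → ∃ λ w → w ∈ₗ childList × Reach (TminusEdge T w t) w (leafOf v)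
      toBranch v t↝v with Reach⇒InSubtree {t} {p ∷ ps} t↝v
      ... | inj₁ v-at-t = ⊥-elim (inner (subst (IsLeaf T) v-at-t (proj₂ (Inverse.from δ v))))
      ... | inj₂ (w , e , w≢p , w↝v) = w , ∈childList⁺ (e , w≢p) , w↝v

      fromBranch : ∀ {w} v → w ∈ₗ childList → Reach (TminusEdge T w t) w (leafOf v) → Reach (TminusEdge T t p) t (leafOf v)
      fromBranch v w∈ w↝v = InSubtree⇒Reach {t} {p ∷ ps} (inj₂ (_ , proj₁ (∈childList⁻ w∈) , proj₂ (∈childList⁻ w∈) , w↝v))

      oneChild : ∀ w → w ∷ [] ≡ childList → SideTree t p
      oneChild w eq with rec w (proj₁ (∈childList⁻ w∈)) (proj₂ (∈childList⁻ w∈))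
        where
        w∈ : w ∈ₗ childList
        w∈ = subst (w ∈ₗ_) eq (here refl)
      ... | β , d , sm , cut-w = β , d , sm , cut
        where
        cut : IsCutOf t p (leaves β)
        cut v = (λ v∈ → fromBranch v (subst (w ∈ₗ_) eq (here refl)) (proj₁ (cut-w v) v∈))
              , (λ t↝v → case (toBranch v t↝v))
          where
          case : (∃ λ w' → w' ∈ₗ childList × Reach (TminusEdge T w' t) w' (leafOf v)) → v ∈ leaves β
          case (w' , w'∈ , w'↝v) with subst (w' ∈ₗ_) (sym eq) w'∈
          ... | here refl = proj₂ (cut-w v) w'↝v

      twoChildren : ∀ w₁ w₂ → w₁ ∷ w₂ ∷ [] ≡ childList → SideTree t p
      twoChildren w₁ w₂ eq with ∈childList⁻ (subst (w₁ ∈ₗ_) eq (here refl)) | ∈childList⁻ (subst (w₂ ∈ₗ_) eq (there (here refl)))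
      ... | e₁ , w₁≢p | e₂ , w₂≢p with rec w₁ e₁ w₁≢p | rec w₂ e₂ w₂≢p
      ... | β₁ , d₁ , sm₁ , cut₁ | β₂ , d₂ , sm₂ , cut₂ =
        node β₁ β₂ , (d₁ , d₂ , disj) , (sm≤-side (node β₁ β₂) cut , sm₁ , sm₂) , cut
        where
        w₁≢w₂ : w₁ ≢ w₂
        w₁≢w₂ with subst Unique (sym eq) childList-unique
        ... | (w₁≢w₂ ∷ []) ∷ _ = w₁≢w₂
        disj : ∀ x → x ∈ leaves β₁ → x ∉ leaves β₂
        disj x x∈₁ x∈₂ = branches-disjoint e₁ e₂ w₁≢w₂ (proj₁ (cut₁ x) x∈₁) (proj₁ (cut₂ x) x∈₂)
        cut : IsCutOf t p (leaves β₁ ∪ leaves β₂)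
        cut v = (λ v∈ → [ (λ v∈₁ → fromBranch v w₁∈ (proj₁ (cut₁ v) v∈₁)) , (λ v∈₂ → fromBranch v w₂∈ (proj₁ (cut₂ v) v∈₂)) ]′
                          (x∈p∪q⁻ (leaves β₁) (leaves β₂) v∈))
              , (λ t↝v → case (toBranch v t↝v))
          where
          w₁∈ : w₁ ∈ₗ childList
          w₁∈ = subst (w₁ ∈ₗ_) eq (here refl)
          w₂∈ : w₂ ∈ₗ childList
          w₂∈ = subst (w₂ ∈ₗ_) eq (there (here refl))
          case : (∃ λ w' → w' ∈ₗ childList × Reach (TminusEdge T w' t) w' (leafOf v)) → v ∈ leaves β₁ ∪ leaves β₂
          case (w' , w'∈ , w'↝v) with subst (w' ∈ₗ_) (sym eq) w'∈
          ... | here refl = x∈p∪q⁺ (inj₁ (proj₂ (cut₁ v) w'↝v))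
          ... | there (here refl) = x∈p∪q⁺ (inj₂ (proj₂ (cut₂ v) w'↝v))

      sideTree : ∀ ws → ws ≡ childList → SideTree t p
      sideTree [] eq = ⊥-elim (inner (degree≤length T t (p ∷ []) only-p))
        where
        only-p : ∀ y → E T t y → y ∈ₗ p ∷ []
        only-p y e with y ≟ p
        ... | yes refl = here refl
        ... | no y≢p with subst (y ∈ₗ_) (sym eq) (∈childList⁺ (e , y≢p))
        ... | ()
      sideTree (w ∷ []) eq = oneChild w eq
      sideTree (w₁ ∷ w₂ ∷ []) eq = twoChildren w₁ w₂ eq
      sideTree (_ ∷ _ ∷ _ ∷ _) eq with subst (λ ws → 1 + length ws ≤ 3) (sym eq) #children≤2
      ... | s≤s (s≤s (s≤s ()))

    sideTree : SideTree t p
    sideTree with degree T t ≤? 1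
    ... | yes leaf-t = leafCase leaf-t
    ... | no inner = Inner.sideTree inner childList refl

  branchTree : ∀ t ps → RootPath t ps → BranchTree t ps
  branchTree = rootedRec BranchTree grow
    where
    grow : ∀ t ps → RootPath t ps → (∀ w → E T t w → NotParent w ps → BranchTree w (t ∷ ps)) → BranchTree t ps
    grow t [] _ _ = tt
    grow t (p ∷ ps) rp rec = Step.sideTree t p ps rp rec

  sides-disjoint : ∀ {r u} → E T r u → ∀ {A B} → IsCutOf r u A → IsCutOf u r B → ∀ x → x ∈ A → x ∉ B
  sides-disjoint e cutr cutu x x∈r x∈u = edge-is-bridge (E-sym T e)
    (Reach-trans (proj₁ (cutu x) x∈u) (Reach-map (TminusEdge-swap T) (Reach-reverse (TminusEdge-sym T) (proj₁ (cutr x) x∈r))))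

  sides-cover : ∀ {r u} → E T r u → ∀ {A B} → IsCutOf r u A → IsCutOf u r B → ∀ v → v ∈ A ∪ B
  sides-cover {r} {u} e cutr cutu v with Reach⇒InSubtree {r} {[]} (proj₁ isTree r (leafOf v))
  ... | inj₁ v-at-r = x∈p∪q⁺ (inj₁ (proj₂ (cutr v) (subst (Reach (TminusEdge T r u) r) (sym v-at-r) here)))
  ... | inj₂ (w , e' , _ , w↝v) with w ≟ u
  ... | yes refl = x∈p∪q⁺ (inj₂ (proj₂ (cutu v) w↝v))
  ... | no w≢u = x∈p∪q⁺ (inj₁ (proj₂ (cutr v) (InSubtree⇒Reach {r} {u ∷ []} (inj₂ (w , e' , w≢u , w↝v)))))

  cw≤-rootedAt : ∀ r u → E T r u → cw≤ G K
  cw≤-rootedAt r u e with branchTree r (u ∷ []) (e ∷ [-] , (E-irrefl T e ∷ []) ∷ [] ∷ [])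
                        | branchTree u (r ∷ []) (E-sym T e ∷ [-] , ((λ u≡r → E-irrefl T e (sym u≡r)) ∷ []) ∷ [] ∷ [])
  ... | βr , dr , smr , cutr | βu , du , smu , cutu
    with rootExpression βr βu (dr , du , sides-disjoint e cutr cutu) smr smu
  ... | expr , eadj≡ =
    cw≤-from expr (leafAt-inverse (node βr βu) (dr , du , sides-disjoint e cutr cutu) (sides-cover e cutr cutu)) eadj≡

smw≤⇒cw≤ : ∀ {n} (G : Graph (suc n)) k → smw≤ G k → cw≤ G (3 * #classes k)
smw≤⇒cw≤ {zero} G k _ = vtx zero , mk↔ₛ′ (λ x → x) (λ x → x) (λ _ → refl) (λ _ → refl) , λ { zero zero → sym (irrefl G zero) }
smw≤⇒cw≤ {suc n} G k (BD , sm≤k) = cw≤-rootedAt (leafOf zero) (proj₁ first) (proj₂ first)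
  where
  open FromBranchDecomposition BD sm≤k
  open BranchDecomposition BD using (T; leafOf; isTree)
  leaves-distinct : leafOf zero ≢ leafOf (suc zero)
  leaves-distinct eq with trans (leafOf≡⇒≡vertexOf zero (leafOf (suc zero)) _ eq) (Inverse.strictlyInverseˡ (BranchDecomposition.δ BD) (suc zero))
  ... | ()
  first : ∃ (E T (leafOf zero))
  first = Reach-first (proj₁ isTree (leafOf zero) (leafOf (suc zero))) leaves-distinct

proposition1 : (∀ n (G : Graph (suc n)) (b : ℕ) → tw+1≤ G b → smw≤ G b)
    ×
    (∀ (C : (n : ℕ) → Graph (suc n) → Set) (k : ℕ) →
    (∀ n G → C n G → smw≤ G k) →
    ∃[ k' ] (∀ n G → C n G → cw≤ G k'))
proposition1 = (λ n G b → tw+1≤⇒smw≤ G b) , λ C k smw≤k → 3 * #classes k , λ n G G∈C → smw≤⇒cw≤ G k (smw≤k n G G∈C)
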